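{- Let $u,v$ be integers with $v > u \geq 0$, and let $K \geq 1$ and $N \geq 0$ be integers. Then there exist rational numbers $a_m$ ($K\le m\le (K+N)v-u$) and $b_\ell$ ($1\le\ell\le K$) such that the polynomial identity \[ \sum_{ K \leq m \leq (K + N) v - u } a_m ( X - 1 )^m = 1 + X^{Nv} \sum_{ 1 \leq \ell \leq K } b_\ell X^{ \ell v - u } \] holds in $\mathbb Q[X]$. The coefficients $(b_\ell)$ are uniquely determined and given by \[ b_\ell = \frac{ (-1)^\ell }{ (\ell - 1)! (K - \ell)! } \prod_{ \substack{ 1 \leq j \leq K \\ j \neq \ell } } \left( j + N - \frac uv \right). \] -}

module Defs where

open import Data.Nat as ℕ using (ℕ; zero; suc; _∸_; _!)
open import Data.Nat.Properties using (_!*_!≢0)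
open import Data.Integer as ℤ using (ℤ; +_; -[1+_])
open import Data.Rational as ℚ using (ℚ; 0ℚ; 1ℚ; _+_; _*_; _-_; -_; _/_)
open import Data.List using (List; []; _∷_; map; foldr; upTo; filter)
open import Relation.Binary.PropositionalEquality using (_≡_)
open import Relation.Nullary using (¬?)

-- Univariate polynomials over ℚ, as coefficient lists (constant term first).
-- Two polynomials are equal in ℚ[X] iff all their coefficients agree.

Poly : Set
Poly = List ℚ

coeff : Poly → ℕ → ℚ
coeff []       _       = 0ℚ
coeff (c ∷ p)  zero    = c
coeff (c ∷ p)  (suc k) = coeff p k

_≐_ : Poly → Poly → Set
p ≐ q = ∀ k → coeff p k ≡ coeff q k

infix 4 _≐_
infixl 6 _+ₚ_
infixl 7 _*ₚ_ _·ₚ_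
infixr 8 _^ₚ_

_+ₚ_ : Poly → Poly → Poly
[]      +ₚ q       = q
(a ∷ p) +ₚ []      = a ∷ p
(a ∷ p) +ₚ (b ∷ q) = (a + b) ∷ (p +ₚ q)

_·ₚ_ : ℚ → Poly → Poly
c ·ₚ p = map (c *_) p

_*ₚ_ : Poly → Poly → Poly
[]      *ₚ q = []
(a ∷ p) *ₚ q = (a ·ₚ q) +ₚ (0ℚ ∷ (p *ₚ q))

constP : ℚ → Poly
constP c = c ∷ []

Xₚ : Poly
Xₚ = 0ℚ ∷ 1ℚ ∷ []

_^ₚ_ : Poly → ℕ → Poly
p ^ₚ zero  = constP 1ℚ
p ^ₚ suc n = p *ₚ (p ^ₚ n)

-- the list [lo, lo+1, ..., hi]  (empty if hi < lo)
range : ℕ → ℕ → List ℕ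
range lo hi = map (lo ℕ.+_) (upTo (suc hi ∸ lo))

sumP : ℕ → ℕ → (ℕ → Poly) → Poly
sumP lo hi f = foldr (λ m acc → f m +ₚ acc) [] (range lo hi)

prodℚ : List ℕ → (ℕ → ℚ) → ℚ
prodℚ xs f = foldr (λ x acc → f x * acc) 1ℚ xs

-- the rational number u / v (only used for v ≥ 1; the value at v = 0 is
-- an irrelevant convention)
fracℕ : ℕ → ℕ → ℚ
fracℕ u zero    = 0ℚ
fracℕ u (suc v) = (+ u) / suc v

ℕ→ℚ : ℕ → ℚ
ℕ→ℚ n = (+ n) / 1

lhs : (u v K N : ℕ) → (ℕ → ℚ) → Poly
lhs u v K N a =
  sumP K ((K ℕ.+ N) ℕ.* v ∸ u) (λ m → a m ·ₚ ((Xₚ +ₚ constP (- 1ℚ)) ^ₚ m))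

rhs : (u v K N : ℕ) → (ℕ → ℚ) → Poly
rhs u v K N b =
  constP 1ℚ +ₚ (Xₚ ^ₚ (N ℕ.* v)) *ₚ sumP 1 K (λ ℓ → b ℓ ·ₚ (Xₚ ^ₚ (ℓ ℕ.* v ∸ u)))

bFormula : (u v K N ℓ : ℕ) → ℚ
bFormula u v K N ℓ =
  ((-[1+ 0 ] ℤ.^ ℓ) / ((ℓ ∸ 1) ! ℕ.* (K ∸ ℓ) !)) {{ (ℓ ∸ 1) !* (K ∸ ℓ) !≢0 }}
  * prodℚ (filter (λ j → ¬? (j ℕ.≟ ℓ)) (range 1 K))
          (λ j → ℕ→ℚ (j ℕ.+ N) - fracℕ u v)

module Submission where

-- The proof pairs polynomials with sequences q : ℕ → ℚ
-- through the linear functional  ⟪ q ∣ p ⟫ = Σᵢ pᵢ q(i)  (Xⁱ ↦ q i):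
--   * ⟪ q ∣ (X - 1)ᵐ ⟫ is the m-th forward difference Δᵐq(0), so the
--     left-hand side is annihilated by every q of degree < K (Δᴷq = 0);
--   * ⟪ q ∣ rhs ⟫ = Λ b q = q(0) + Σ_ℓ b_ℓ q(e_ℓ), exponents e_ℓ = Nv + ℓv - u.
-- Uniqueness: for each ℓ the Lagrange-type sequence ∏_{j ≠ ℓ} (i - e_j) has
-- degree < K and isolates b_ℓ in Λ b, so a solution determines b.
-- Existence: for the closed formula b, Λ b vanishes on the binomial sequences
-- i ↦ (i choose j), j < K (induction on K through two recurrences of the
-- closed formula, one in K and one in N).  These values are the Taylor
-- coefficients of rhs at X = 1, and its Taylor expansion (repeated synthetic
-- division by X - 1, again read through the pairing) provides the a_m.

open import Defs
open import Data.Nat as ℕ using (ℕ; zero; suc; _∸_; _≤_; _<_; z≤n; s≤s; _!)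
import Data.Nat.Properties as ℕP
open import Data.Integer as ℤ using (ℤ; +_; -[1+_])
import Data.Integer.Properties as ℤP
open import Data.Rational as ℚ using (ℚ; 0ℚ; 1ℚ; _+_; _*_; _-_; -_; _/_)
import Data.Rational.Properties as ℚP
open import Data.Rational.Unnormalised as ℚᵘ using (mkℚᵘ; *≡*)
import Data.Rational.Unnormalised.Properties as ℚᵘP
open import Data.Rational.Solver using (module +-*-Solver)
open import Data.List using (List; []; _∷_; map; foldr; upTo; filter; applyUpTo; _++_)
import Data.List.Properties as LP
open import Data.Product using (Σ; _×_; _,_)
open import Data.Bool using (true; false)
open import Data.Empty using (⊥-elim)
open import Relation.Binary.PropositionalEquality
open import Relation.Nullary using (yes; no; ¬?)
open import Algebra.Properties.Group ℚP.+-0-group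
  using (x∙y⁻¹≈ε⇒x≈y; inverseˡ-unique; ∙-cancelˡ)
open import Algebra.Properties.CommutativeSemigroup ℕP.*-commutativeSemigroup
  using (x∙yz≈y∙xz)

open +-*-Solver

fromℚᵘ-+ : ∀ p q → ℚ.fromℚᵘ (p ℚᵘ.+ q) ≡ ℚ.fromℚᵘ p + ℚ.fromℚᵘ q
fromℚᵘ-+ p q = ℚP.toℚᵘ-injective (ℚᵘP.≃-trans (ℚP.toℚᵘ-fromℚᵘ _)
  (ℚᵘP.≃-sym (ℚᵘP.≃-trans (ℚP.toℚᵘ-homo-+ (ℚ.fromℚᵘ p) (ℚ.fromℚᵘ q))
                          (ℚᵘP.+-cong (ℚP.toℚᵘ-fromℚᵘ p) (ℚP.toℚᵘ-fromℚᵘ q)))))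

fromℚᵘ-* : ∀ p q → ℚ.fromℚᵘ (p ℚᵘ.* q) ≡ ℚ.fromℚᵘ p * ℚ.fromℚᵘ q
fromℚᵘ-* p q = ℚP.toℚᵘ-injective (ℚᵘP.≃-trans (ℚP.toℚᵘ-fromℚᵘ _)
  (ℚᵘP.≃-sym (ℚᵘP.≃-trans (ℚP.toℚᵘ-homo-* (ℚ.fromℚᵘ p) (ℚ.fromℚᵘ q))
                          (ℚᵘP.*-cong (ℚP.toℚᵘ-fromℚᵘ p) (ℚP.toℚᵘ-fromℚᵘ q)))))

-- The integer z as a rational number (definitionally  fromℚᵘ (mkℚᵘ z 0)).
ℤ→ℚ : ℤ → ℚ
ℤ→ℚ z = z / 1

ℤ→ℚ-+ : ∀ a b → ℤ→ℚ (a ℤ.+ b) ≡ ℤ→ℚ a + ℤ→ℚ b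
ℤ→ℚ-+ a b = trans (ℚP.fromℚᵘ-cong {mkℚᵘ (a ℤ.+ b) 0} {mkℚᵘ a 0 ℚᵘ.+ mkℚᵘ b 0}
  (*≡* (cong (ℤ._* + 1) same))) (fromℚᵘ-+ (mkℚᵘ a 0) (mkℚᵘ b 0))
  where
  same : a ℤ.+ b ≡ a ℤ.* + 1 ℤ.+ b ℤ.* + 1
  same = sym (cong₂ ℤ._+_ (ℤP.*-identityʳ a) (ℤP.*-identityʳ b))

ℤ→ℚ-* : ∀ a b → ℤ→ℚ (a ℤ.* b) ≡ ℤ→ℚ a * ℤ→ℚ b
ℤ→ℚ-* a b = trans (ℚP.fromℚᵘ-cong {mkℚᵘ (a ℤ.* b) 0} {mkℚᵘ a 0 ℚᵘ.* mkℚᵘ b 0} (*≡* refl))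
                  (fromℚᵘ-* (mkℚᵘ a 0) (mkℚᵘ b 0))

ℤ→ℚ-neg : ∀ a → ℤ→ℚ (ℤ.- a) ≡ - ℤ→ℚ a
ℤ→ℚ-neg a = inverseˡ-unique _ _ (trans (sym (ℤ→ℚ-+ (ℤ.- a) a)) (cong ℤ→ℚ (ℤP.+-inverseˡ a)))

ℕ→ℚ-+ : ∀ m n → ℕ→ℚ (m ℕ.+ n) ≡ ℕ→ℚ m + ℕ→ℚ n
ℕ→ℚ-+ m n = trans (cong ℤ→ℚ (ℤP.pos-+ m n)) (ℤ→ℚ-+ (+ m) (+ n))

ℕ→ℚ-* : ∀ m n → ℕ→ℚ (m ℕ.* n) ≡ ℕ→ℚ m * ℕ→ℚ n
ℕ→ℚ-* m n = trans (cong ℤ→ℚ (ℤP.pos-* m n)) (ℤ→ℚ-* (+ m) (+ n))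

ℕ→ℚ-suc : ∀ n → ℕ→ℚ (suc n) ≡ 1ℚ + ℕ→ℚ n
ℕ→ℚ-suc = ℕ→ℚ-+ 1

ℕ→ℚ-∸ : ∀ m n → n ≤ m → ℕ→ℚ (m ∸ n) ≡ ℕ→ℚ m - ℕ→ℚ n
ℕ→ℚ-∸ m n n≤m = begin
  ℕ→ℚ (m ∸ n)
    ≡⟨ solve 2 (λ x y → x := (x :+ y) :- y) refl (ℕ→ℚ (m ∸ n)) (ℕ→ℚ n) ⟩
  (ℕ→ℚ (m ∸ n) + ℕ→ℚ n) - ℕ→ℚ n
    ≡⟨ cong (_- ℕ→ℚ n) (sym (ℕ→ℚ-+ (m ∸ n) n)) ⟩
  ℕ→ℚ (m ∸ n ℕ.+ n) - ℕ→ℚ n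
    ≡⟨ cong (λ k → ℕ→ℚ k - ℕ→ℚ n) (ℕP.m∸n+n≡m n≤m) ⟩
  ℕ→ℚ m - ℕ→ℚ n ∎
  where open ≡-Reasoning

ℕ→ℚ-injective : ∀ m n → ℕ→ℚ m ≡ ℕ→ℚ n → m ≡ n
ℕ→ℚ-injective m n h with ℚᵘP.≃-trans (ℚᵘP.≃-sym (ℚP.toℚᵘ-fromℚᵘ (mkℚᵘ (+ m) 0)))
                          (ℚᵘP.≃-trans (ℚP.toℚᵘ-cong h) (ℚP.toℚᵘ-fromℚᵘ (mkℚᵘ (+ n) 0)))
... | *≡* eq = ℤP.+-injective (trans (sym (ℤP.*-identityʳ (+ m))) (trans eq (ℤP.*-identityʳ (+ n))))

ℕ→ℚ-nonZero : ∀ n .{{_ : ℕ.NonZero n}} → ℕ→ℚ n ≢ 0ℚ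
ℕ→ℚ-nonZero (suc n) h with ℕ→ℚ-injective (suc n) 0 h
... | ()

/-*-inverse : ∀ z d .{{_ : ℕ.NonZero d}} → (z / d) * ℕ→ℚ d ≡ ℤ→ℚ z
/-*-inverse z (suc d) = trans (sym (fromℚᵘ-* (mkℚᵘ z d) (mkℚᵘ (+ suc d) 0)))
  (ℚP.fromℚᵘ-cong {mkℚᵘ z d ℚᵘ.* mkℚᵘ (+ suc d) 0} {mkℚᵘ z 0} (*≡* eq))
  where
  eq : (z ℤ.* + suc d) ℤ.* + 1 ≡ z ℤ.* + (suc d ℕ.* 1)
  eq = trans (ℤP.*-identityʳ _) (cong (λ x → z ℤ.* + x) (sym (ℕP.*-identityʳ (suc d))))

*-cancelʳ-≢0 : ∀ c x y → c ≢ 0ℚ → x * c ≡ y * c → x ≡ y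
*-cancelʳ-≢0 c x y c≢0 h = begin
  x                 ≡⟨ sym (ℚP.*-identityʳ x) ⟩
  x * 1ℚ            ≡⟨ cong (x *_) (sym (ℚP.*-inverseʳ c)) ⟩
  x * (c * 1/c)     ≡⟨ sym (ℚP.*-assoc x c 1/c) ⟩
  (x * c) * 1/c     ≡⟨ cong (_* 1/c) h ⟩
  (y * c) * 1/c     ≡⟨ ℚP.*-assoc y c 1/c ⟩
  y * (c * 1/c)     ≡⟨ cong (y *_) (ℚP.*-inverseʳ c) ⟩
  y * 1ℚ            ≡⟨ ℚP.*-identityʳ y ⟩
  y                 ∎
  where
  open ≡-Reasoning
  instance
    c-nonZero : ℚ.NonZero c
    c-nonZero = ℚ.≢-nonZero c≢0
  1/c = ℚ.1/ c

≢0-*-zero : ∀ c x → c ≢ 0ℚ → c * x ≡ 0ℚ → x ≡ 0ℚ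
≢0-*-zero c x c≢0 h = *-cancelʳ-≢0 c x 0ℚ c≢0 (trans (ℚP.*-comm x c) (trans h (sym (ℚP.*-zeroˡ c))))

Σ< : ℕ → (ℕ → ℚ) → ℚ
Σ< zero    g = 0ℚ
Σ< (suc n) g = Σ< n g + g n

Σ₁ : ℕ → (ℕ → ℚ) → ℚ
Σ₁ K f = Σ< K (λ i → f (suc i))

Σ<-cong : ∀ n {f g} → (∀ i → i < n → f i ≡ g i) → Σ< n f ≡ Σ< n g
Σ<-cong zero    h = refl
Σ<-cong (suc n) h = cong₂ _+_ (Σ<-cong n (λ i i<n → h i (ℕP.m≤n⇒m≤1+n i<n))) (h n ℕP.≤-refl)

Σ<-zero : ∀ n f → (∀ i → i < n → f i ≡ 0ℚ) → Σ< n f ≡ 0ℚ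
Σ<-zero zero    f h = refl
Σ<-zero (suc n) f h =
  trans (cong₂ _+_ (Σ<-zero n f (λ i i<n → h i (ℕP.m≤n⇒m≤1+n i<n))) (h n ℕP.≤-refl))
        (ℚP.+-identityʳ 0ℚ)

Σ<-front : ∀ n g → Σ< (suc n) g ≡ g 0 + Σ< n (λ i → g (suc i))
Σ<-front zero    g = trans (ℚP.+-identityˡ (g 0)) (sym (ℚP.+-identityʳ (g 0)))
Σ<-front (suc n) g = trans (cong (_+ g (suc n)) (Σ<-front n g)) (ℚP.+-assoc (g 0) _ (g (suc n)))

Σ<-linear : ∀ n s t f g → Σ< n (λ i → s * f i + t * g i) ≡ s * Σ< n f + t * Σ< n g
Σ<-linear zero    s t f g = solve 2 (λ s t → con 0ℚ := s :* con 0ℚ :+ t :* con 0ℚ) refl s t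
Σ<-linear (suc n) s t f g = trans (cong (_+ (s * f n + t * g n)) (Σ<-linear n s t f g))
  (solve 6 (λ s t F G x y → (s :* F :+ t :* G) :+ (s :* x :+ t :* y) := s :* (F :+ x) :+ t :* (G :+ y))
         refl s t (Σ< n f) (Σ< n g) (f n) (g n))

Σ<-scale : ∀ n a f → Σ< n (λ i → a * f i) ≡ a * Σ< n f
Σ<-scale zero    a f = sym (ℚP.*-zeroʳ a)
Σ<-scale (suc n) a f = trans (cong (_+ a * f n) (Σ<-scale n a f)) (sym (ℚP.*-distribˡ-+ a (Σ< n f) (f n)))

Σ₁-cong : ∀ K {f g} → (∀ ℓ → 1 ≤ ℓ → ℓ ≤ K → f ℓ ≡ g ℓ) → Σ₁ K f ≡ Σ₁ K g
Σ₁-cong K h = Σ<-cong K (λ i i<K → h (suc i) (s≤s z≤n) i<K)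

Σ₁-single : ∀ K ℓ f → 1 ≤ ℓ → ℓ ≤ K →
            (∀ j → 1 ≤ j → j ≤ K → j ≢ ℓ → f j ≡ 0ℚ) → Σ₁ K f ≡ f ℓ
Σ₁-single zero    ℓ f 1≤ℓ ℓ≤0 h with () ← ℕP.≤-trans 1≤ℓ ℓ≤0
Σ₁-single (suc K) ℓ f 1≤ℓ ℓ≤K h with ℓ ℕ.≟ suc K
... | yes refl = trans (cong (_+ f (suc K)) (Σ<-zero K _ others)) (ℚP.+-identityˡ (f (suc K)))
  where
  others : ∀ i → i < K → f (suc i) ≡ 0ℚ
  others i i<K = h (suc i) (s≤s z≤n) (s≤s (ℕP.<⇒≤ i<K))
                   (λ i≡K → ℕP.<-irrefl (ℕP.suc-injective i≡K) i<K)
... | no ℓ≢K = trans (cong₂ _+_ (Σ₁-single K ℓ f 1≤ℓ ℓ≤K' (λ j a b → h j a (ℕP.m≤n⇒m≤1+n b)))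
                                 (h (suc K) (s≤s z≤n) ℕP.≤-refl (λ e → ℓ≢K (sym e))))
                     (ℚP.+-identityʳ (f ℓ))
  where
  ℓ≤K' : ℓ ≤ K
  ℓ≤K' = ℕP.≤-pred (ℕP.≤∧≢⇒< ℓ≤K ℓ≢K)

sumℚ : List ℕ → (ℕ → ℚ) → ℚ
sumℚ xs f = foldr (λ x acc → f x + acc) 0ℚ xs

sumℚ-cong : ∀ xs {f g} → (∀ i → f i ≡ g i) → sumℚ xs f ≡ sumℚ xs g
sumℚ-cong []       h = refl
sumℚ-cong (x ∷ xs) h = cong₂ _+_ (h x) (sumℚ-cong xs h)

sumℚ-applyUpTo : ∀ n h f → sumℚ (applyUpTo h n) f ≡ Σ< n (λ i → f (h i))
sumℚ-applyUpTo zero    h f = refl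
sumℚ-applyUpTo (suc n) h f =
  trans (cong (λ t → f (h 0) + t) (sumℚ-applyUpTo n (λ i → h (suc i)) f)) (sym (Σ<-front n (λ i → f (h i))))

sumℚ-range : ∀ lo hi f → sumℚ (range lo hi) f ≡ Σ< (suc hi ∸ lo) (λ i → f (lo ℕ.+ i))
sumℚ-range lo hi f = trans (cong (λ xs → sumℚ xs f) (LP.map-applyUpTo (λ i → i) (lo ℕ.+_) (suc hi ∸ lo)))
                           (sumℚ-applyUpTo (suc hi ∸ lo) (lo ℕ.+_) f)

shift : (ℕ → ℚ) → ℕ → ℚ
shift q i = q (suc i)

shiftBy : ℕ → (ℕ → ℚ) → ℕ → ℚ
shiftBy n q j = q (n ℕ.+ j)

one : ℕ → ℚ
one _ = 1ℚ

Δ : (ℕ → ℚ) → ℕ → ℚ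
Δ q i = q (suc i) - q i

Δ^ : ℕ → (ℕ → ℚ) → ℕ → ℚ
Δ^ zero    q = q
Δ^ (suc n) q = Δ^ n (Δ q)

-- q is a polynomial sequence of degree < n (its n-th differences vanish).
DegBelow : ℕ → (ℕ → ℚ) → Set
DegBelow n q = ∀ i → Δ^ n q i ≡ 0ℚ

Δ^-cong : ∀ n {f g} → (∀ i → f i ≡ g i) → ∀ i → Δ^ n f i ≡ Δ^ n g i
Δ^-cong zero    h i = h i
Δ^-cong (suc n) h   = Δ^-cong n (λ i → cong₂ _-_ (h (suc i)) (h i))

Δ^-+ : ∀ n f g i → Δ^ n (λ j → f j + g j) i ≡ Δ^ n f i + Δ^ n g i
Δ^-+ zero    f g i = refl
Δ^-+ (suc n) f g i = trans (Δ^-cong n {g = λ j → Δ f j + Δ g j} regroup i) (Δ^-+ n (Δ f) (Δ g) i)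
  where
  regroup : ∀ j → Δ (λ j → f j + g j) j ≡ Δ f j + Δ g j
  regroup j = solve 4 (λ a b c d → (a :+ b) :- (c :+ d) := (a :- c) :+ (b :- d)) refl
                      (f (suc j)) (g (suc j)) (f j) (g j)

Δ^-shift : ∀ n f i → Δ^ n (shift f) i ≡ Δ^ n f (suc i)
Δ^-shift zero    f i = refl
Δ^-shift (suc n) f i = Δ^-shift n (Δ f) i

Δ^-Δ : ∀ n f i → Δ^ n (Δ f) i ≡ Δ (Δ^ n f) i
Δ^-Δ zero    f i = refl
Δ^-Δ (suc n) f i = Δ^-Δ n (Δ f) i

DegBelow-suc : ∀ n f → DegBelow n f → DegBelow (suc n) f
DegBelow-suc n f h i = trans (Δ^-Δ n f i) (cong₂ _-_ (h (suc i)) (h i))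

DegBelow-raise : ∀ n k f → DegBelow n f → DegBelow (n ℕ.+ k) f
DegBelow-raise n zero    f h = subst (λ m → DegBelow m f) (sym (ℕP.+-identityʳ n)) h
DegBelow-raise n (suc k) f h =
  subst (λ m → DegBelow m f) (sym (ℕP.+-suc n k)) (DegBelow-suc (n ℕ.+ k) f (DegBelow-raise n k f h))

DegBelow-cong : ∀ n {f g} → (∀ i → f i ≡ g i) → DegBelow n f → DegBelow n g
DegBelow-cong n f≗g h i = trans (sym (Δ^-cong n f≗g i)) (h i)

DegBelow-one : DegBelow 1 one
DegBelow-one i = ℚP.+-inverseʳ 1ℚ

DegBelow-linearFactor : ∀ n c q → DegBelow n q → DegBelow (suc n) (λ i → (ℕ→ℚ i - c) * q i)
DegBelow-linearFactor zero c q h =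
  DegBelow-suc zero _ (λ i → trans (cong ((ℕ→ℚ i - c) *_) (h i)) (ℚP.*-zeroʳ (ℕ→ℚ i - c)))
DegBelow-linearFactor (suc n) c q h = DegBelow-cong (suc n) (λ i → sym (Δ-product i)) sum-deg
  where
  Δ-product : ∀ i → Δ (λ i → (ℕ→ℚ i - c) * q i) i ≡ (ℕ→ℚ i - c) * Δ q i + q (suc i)
  Δ-product i = trans (cong (λ t → (t - c) * q (suc i) - (ℕ→ℚ i - c) * q i) (ℕ→ℚ-suc i))
    (solve 4 (λ x c a b → (con 1ℚ :+ x :- c) :* a :- (x :- c) :* b := (x :- c) :* (a :- b) :+ a)
           refl (ℕ→ℚ i) c (q (suc i)) (q i))
  sum-deg : DegBelow (suc n) (λ i → (ℕ→ℚ i - c) * Δ q i + q (suc i))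
  sum-deg i = trans (Δ^-+ (suc n) (λ i → (ℕ→ℚ i - c) * Δ q i) (shift q) i)
    (cong₂ _+_ (DegBelow-linearFactor n c (Δ q) h i) (trans (Δ^-shift (suc n) q i) (h (suc i))))

-- Pairing polynomials with sequences.

⟪_∣_⟫ : (ℕ → ℚ) → Poly → ℚ
⟪ q ∣ []    ⟫ = 0ℚ
⟪ q ∣ c ∷ p ⟫ = c * q 0 + ⟪ shift q ∣ p ⟫

pair-cong : ∀ {q r} p → (∀ i → q i ≡ r i) → ⟪ q ∣ p ⟫ ≡ ⟪ r ∣ p ⟫
pair-cong []      h = refl
pair-cong (c ∷ p) h = cong₂ _+_ (cong (c *_) (h 0)) (pair-cong p (λ i → h (suc i)))

pair-linear : ∀ s t f g p → ⟪ (λ i → s * f i + t * g i) ∣ p ⟫ ≡ s * ⟪ f ∣ p ⟫ + t * ⟪ g ∣ p ⟫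
pair-linear s t f g []      = solve 2 (λ s t → con 0ℚ := s :* con 0ℚ :+ t :* con 0ℚ) refl s t
pair-linear s t f g (c ∷ p) =
  trans (cong (λ r → c * (s * f 0 + t * g 0) + r) (pair-linear s t (shift f) (shift g) p))
    (solve 7 (λ c s t x y F G → c :* (s :* x :+ t :* y) :+ (s :* F :+ t :* G)
                                := s :* (c :* x :+ F) :+ t :* (c :* y :+ G))
           refl c s t (f 0) (g 0) ⟪ shift f ∣ p ⟫ ⟪ shift g ∣ p ⟫)

pair-null : ∀ q p → [] ≐ p → ⟪ q ∣ p ⟫ ≡ 0ℚ
pair-null q []      h = refl
pair-null q (c ∷ p) h = trans (cong₂ _+_ (cong (_* q 0) (sym (h 0))) (pair-null (shift q) p (λ k → h (suc k))))
                              (solve 1 (λ x → con 0ℚ :* x :+ con 0ℚ := con 0ℚ) refl (q 0))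

pair-≐ : ∀ q {p p'} → p ≐ p' → ⟪ q ∣ p ⟫ ≡ ⟪ q ∣ p' ⟫
pair-≐ q {[]}    {p'}     h = sym (pair-null q p' h)
pair-≐ q {c ∷ p} {[]}     h = pair-null q (c ∷ p) (λ k → sym (h k))
pair-≐ q {a ∷ p} {b ∷ p'} h = cong₂ _+_ (cong (_* q 0) (h 0)) (pair-≐ (shift q) {p} {p'} (λ k → h (suc k)))

pair-+ₚ : ∀ q p p' → ⟪ q ∣ p +ₚ p' ⟫ ≡ ⟪ q ∣ p ⟫ + ⟪ q ∣ p' ⟫
pair-+ₚ q []      p'       = sym (ℚP.+-identityˡ _)
pair-+ₚ q (a ∷ p) []       = sym (ℚP.+-identityʳ _)
pair-+ₚ q (a ∷ p) (b ∷ p') = trans (cong (λ r → (a + b) * q 0 + r) (pair-+ₚ (shift q) p p'))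
  (solve 5 (λ a b x P P' → (a :+ b) :* x :+ (P :+ P') := (a :* x :+ P) :+ (b :* x :+ P'))
         refl a b (q 0) ⟪ shift q ∣ p ⟫ ⟪ shift q ∣ p' ⟫)

pair-·ₚ : ∀ q c p → ⟪ q ∣ c ·ₚ p ⟫ ≡ c * ⟪ q ∣ p ⟫
pair-·ₚ q c []      = sym (ℚP.*-zeroʳ c)
pair-·ₚ q c (a ∷ p) = trans (cong (λ r → (c * a) * q 0 + r) (pair-·ₚ (shift q) c p))
  (solve 4 (λ c a x P → (c :* a) :* x :+ c :* P := c :* (a :* x :+ P)) refl c a (q 0) ⟪ shift q ∣ p ⟫)

pair-sum : ∀ q xs (f : ℕ → Poly) →
           ⟪ q ∣ foldr (λ m acc → f m +ₚ acc) [] xs ⟫ ≡ sumℚ xs (λ m → ⟪ q ∣ f m ⟫)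
pair-sum q []       f = refl
pair-sum q (x ∷ xs) f = trans (pair-+ₚ q (f x) _) (cong (λ r → ⟪ q ∣ f x ⟫ + r) (pair-sum q xs f))

pair-*ₚ : ∀ q p r → ⟪ q ∣ p *ₚ r ⟫ ≡ ⟪ (λ i → ⟪ shiftBy i q ∣ r ⟫) ∣ p ⟫
pair-*ₚ q []      r = refl
pair-*ₚ q (a ∷ p) r = begin
  ⟪ q ∣ (a ·ₚ r) +ₚ (0ℚ ∷ (p *ₚ r)) ⟫
    ≡⟨ pair-+ₚ q (a ·ₚ r) _ ⟩
  ⟪ q ∣ a ·ₚ r ⟫ + (0ℚ * q 0 + ⟪ shift q ∣ p *ₚ r ⟫)
    ≡⟨ cong₂ (λ s t → s + (0ℚ * q 0 + t)) (pair-·ₚ q a r)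
             (pair-*ₚ (shift q) p r) ⟩
  a * ⟪ q ∣ r ⟫ + (0ℚ * q 0 + rest)
    ≡⟨ solve 4 (λ a x y Z → a :* x :+ (con 0ℚ :* y :+ Z) := a :* x :+ Z)
             refl a ⟪ q ∣ r ⟫ (q 0) rest ⟩
  a * ⟪ q ∣ r ⟫ + rest ∎
  where
  open ≡-Reasoning
  rest = ⟪ (λ i → ⟪ shiftBy (suc i) q ∣ r ⟫) ∣ p ⟫

pair-X^ : ∀ q n → ⟪ q ∣ Xₚ ^ₚ n ⟫ ≡ q n
pair-X^ q zero    = trans (ℚP.+-identityʳ _) (ℚP.*-identityˡ _)
pair-X^ q (suc n) = begin
  ⟪ q ∣ Xₚ *ₚ (Xₚ ^ₚ n) ⟫
    ≡⟨ pair-*ₚ q Xₚ (Xₚ ^ₚ n) ⟩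
  0ℚ * ⟪ q ∣ Xₚ ^ₚ n ⟫ + (1ℚ * ⟪ shift q ∣ Xₚ ^ₚ n ⟫ + 0ℚ)
    ≡⟨ cong (λ t → 0ℚ * ⟪ q ∣ Xₚ ^ₚ n ⟫ + (1ℚ * t + 0ℚ))
           (pair-X^ (shift q) n) ⟩
  0ℚ * ⟪ q ∣ Xₚ ^ₚ n ⟫ + (1ℚ * q (suc n) + 0ℚ)
    ≡⟨ solve 2 (λ x y → con 0ℚ :* x :+ (con 1ℚ :* y :+ con 0ℚ) := y)
              refl ⟪ q ∣ Xₚ ^ₚ n ⟫ (q (suc n)) ⟩
  q (suc n) ∎
  where open ≡-Reasoning

pair-X^*ₚ : ∀ q n r → ⟪ q ∣ (Xₚ ^ₚ n) *ₚ r ⟫ ≡ ⟪ shiftBy n q ∣ r ⟫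
pair-X^*ₚ q n r = trans (pair-*ₚ q (Xₚ ^ₚ n) r) (pair-X^ (λ i → ⟪ shiftBy i q ∣ r ⟫) n)

Xm1 : Poly
Xm1 = Xₚ +ₚ constP (- 1ℚ)

pair-Xm1*ₚ : ∀ q Q → ⟪ q ∣ Xm1 *ₚ Q ⟫ ≡ ⟪ Δ q ∣ Q ⟫
pair-Xm1*ₚ q Q = begin
  ⟪ q ∣ Xm1 *ₚ Q ⟫
    ≡⟨ pair-*ₚ q Xm1 Q ⟩
  (0ℚ + - 1ℚ) * ⟪ q ∣ Q ⟫ + (1ℚ * ⟪ shift q ∣ Q ⟫ + 0ℚ)
    ≡⟨ solve 2 (λ x y → (con 0ℚ :+ (:- con 1ℚ)) :* x :+ (con 1ℚ :* y :+ con 0ℚ)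
              := con 1ℚ :* y :+ (:- con 1ℚ) :* x)
              refl ⟪ q ∣ Q ⟫ ⟪ shift q ∣ Q ⟫ ⟩
  1ℚ * ⟪ shift q ∣ Q ⟫ + (- 1ℚ) * ⟪ q ∣ Q ⟫
    ≡⟨ sym (pair-linear 1ℚ (- 1ℚ) (shift q) q Q) ⟩
  ⟪ (λ i → 1ℚ * q (suc i) + (- 1ℚ) * q i) ∣ Q ⟫
    ≡⟨ pair-cong Q (λ i → solve 2 (λ a b → con 1ℚ :* a :+ (:- con 1ℚ) :* b := a :- b)
                              refl (q (suc i)) (q i)) ⟩
  ⟪ Δ q ∣ Q ⟫ ∎
  where open ≡-Reasoning

pair-Xm1^ : ∀ q m → ⟪ q ∣ Xm1 ^ₚ m ⟫ ≡ Δ^ m q 0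
pair-Xm1^ q zero    = trans (ℚP.+-identityʳ _) (ℚP.*-identityˡ _)
pair-Xm1^ q (suc m) = trans (pair-Xm1*ₚ q (Xm1 ^ₚ m)) (pair-Xm1^ (Δ q) m)

δ : ℕ → ℕ → ℚ
δ zero    zero    = 1ℚ
δ zero    (suc i) = 0ℚ
δ (suc k) zero    = 0ℚ
δ (suc k) (suc i) = δ k i

δ-off : ∀ k i → i ≢ k → δ k i ≡ 0ℚ
δ-off zero    zero    i≢k = ⊥-elim (i≢k refl)
δ-off zero    (suc i) i≢k = refl
δ-off (suc k) zero    i≢k = refl
δ-off (suc k) (suc i) i≢k = δ-off k i (λ e → i≢k (cong suc e))

pair-zero : ∀ p → ⟪ (λ _ → 0ℚ) ∣ p ⟫ ≡ 0ℚ
pair-zero []      = refl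
pair-zero (c ∷ p) = trans (cong (λ r → c * 0ℚ + r) (pair-zero p))
                          (solve 1 (λ c → c :* con 0ℚ :+ con 0ℚ := con 0ℚ) refl c)

pair-δ : ∀ k p → ⟪ δ k ∣ p ⟫ ≡ coeff p k
pair-δ k       []      = refl
pair-δ zero    (c ∷ p) = trans (cong₂ _+_ (ℚP.*-identityʳ c) (pair-zero p)) (ℚP.+-identityʳ c)
pair-δ (suc k) (c ∷ p) = trans (cong₂ _+_ (ℚP.*-zeroʳ c) (pair-δ k p)) (ℚP.+-identityˡ _)

pair-lhs : ∀ u v K N a q → let D = (K ℕ.+ N) ℕ.* v ∸ u in
           ⟪ q ∣ lhs u v K N a ⟫ ≡ Σ< (suc D ∸ K) (λ i → a (K ℕ.+ i) * Δ^ (K ℕ.+ i) q 0)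
pair-lhs u v K N a q =
  trans (pair-sum q (range K D) (λ m → a m ·ₚ (Xm1 ^ₚ m)))
    (trans (sumℚ-range K D (λ m → ⟪ q ∣ a m ·ₚ (Xm1 ^ₚ m) ⟫))
           (Σ<-cong (suc D ∸ K) (λ i _ → trans (pair-·ₚ q (a (K ℕ.+ i)) (Xm1 ^ₚ (K ℕ.+ i)))
                                                (cong (a (K ℕ.+ i) *_) (pair-Xm1^ q (K ℕ.+ i))))))
  where D = (K ℕ.+ N) ℕ.* v ∸ u

pair-lhs-vanishes : ∀ u v K N a q → DegBelow K q → ⟪ q ∣ lhs u v K N a ⟫ ≡ 0ℚ
pair-lhs-vanishes u v K N a q deg = trans (pair-lhs u v K N a q)
  (Σ<-zero (suc ((K ℕ.+ N) ℕ.* v ∸ u) ∸ K) (λ i → a (K ℕ.+ i) * Δ^ (K ℕ.+ i) q 0) (λ i _ →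
  trans (cong (a (K ℕ.+ i) *_) (DegBelow-raise K i q deg 0)) (ℚP.*-zeroʳ (a (K ℕ.+ i)))))

expo : ℕ → ℕ → ℕ → ℕ → ℕ
expo u v N ℓ = N ℕ.* v ℕ.+ (ℓ ℕ.* v ∸ u)

Λ : ℕ → ℕ → ℕ → ℕ → (ℕ → ℚ) → (ℕ → ℚ) → ℚ
Λ u v K N b q = q 0 + Σ₁ K (λ ℓ → b ℓ * q (expo u v N ℓ))

pair-rhs : ∀ u v K N b q → ⟪ q ∣ rhs u v K N b ⟫ ≡ Λ u v K N b q
pair-rhs u v K N b q = begin
  ⟪ q ∣ rhs u v K N b ⟫
    ≡⟨ pair-+ₚ q (constP 1ℚ) (Xₚ ^ₚ (N ℕ.* v) *ₚ S) ⟩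
  (1ℚ * q 0 + 0ℚ) + ⟪ q ∣ Xₚ ^ₚ (N ℕ.* v) *ₚ S ⟫
    ≡⟨ cong₂ _+_ (trans (ℚP.+-identityʳ (1ℚ * q 0)) (ℚP.*-identityˡ (q 0)))
               (pair-X^*ₚ q (N ℕ.* v) S) ⟩
  q 0 + ⟪ q' ∣ S ⟫
    ≡⟨ cong (λ r → q 0 + r) (trans (pair-sum q' (range 1 K) monomial)
         (trans (sumℚ-cong (range 1 K) pair-monomial)
                (sumℚ-range 1 K (λ ℓ → b ℓ * q (expo u v N ℓ))))) ⟩
  Λ u v K N b q ∎
  where
  open ≡-Reasoning
  monomial : ℕ → Poly
  monomial ℓ = b ℓ ·ₚ (Xₚ ^ₚ (ℓ ℕ.* v ∸ u))
  S = sumP 1 K monomial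
  q' = shiftBy (N ℕ.* v) q
  pair-monomial : ∀ ℓ → ⟪ q' ∣ monomial ℓ ⟫ ≡ b ℓ * q (expo u v N ℓ)
  pair-monomial ℓ = trans (pair-·ₚ q' (b ℓ) (Xₚ ^ₚ (ℓ ℕ.* v ∸ u)))
                          (cong (b ℓ *_) (pair-X^ q' (ℓ ℕ.* v ∸ u)))

Λ-cong : ∀ u v K N b {f g} → (∀ i → f i ≡ g i) → Λ u v K N b f ≡ Λ u v K N b g
Λ-cong u v K N b h = cong₂ _+_ (h 0) (Σ₁-cong K (λ ℓ _ _ → cong (b ℓ *_) (h (expo u v N ℓ))))

Λ-linear : ∀ u v K N b s t f g →
           Λ u v K N b (λ i → s * f i + t * g i) ≡ s * Λ u v K N b f + t * Λ u v K N b g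
Λ-linear u v K N b s t f g = begin
  (s * f 0 + t * g 0) + Σ₁ K (λ ℓ → b ℓ * (s * f (e ℓ) + t * g (e ℓ)))
    ≡⟨ cong (λ r → (s * f 0 + t * g 0) + r)
        (trans (Σ₁-cong K (λ ℓ _ _ → distribute ℓ))
               (Σ<-linear K s t _ _)) ⟩
  (s * f 0 + t * g 0) + (s * SF + t * SG)
    ≡⟨ solve 6 (λ s t x y X Y → (s :* x :+ t :* y) :+ (s :* X :+ t :* Y)
                  := s :* (x :+ X) :+ t :* (y :+ Y))
               refl s t (f 0) (g 0) SF SG ⟩
  s * Λ u v K N b f + t * Λ u v K N b g ∎
  where
  open ≡-Reasoning
  e = expo u v N
  SF = Σ₁ K (λ ℓ → b ℓ * f (e ℓ))
  SG = Σ₁ K (λ ℓ → b ℓ * g (e ℓ))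
  distribute : ∀ ℓ → b ℓ * (s * f (e ℓ) + t * g (e ℓ)) ≡ s * (b ℓ * f (e ℓ)) + t * (b ℓ * g (e ℓ))
  distribute ℓ = solve 5 (λ b s t x y → b :* (s :* x :+ t :* y) := s :* (b :* x) :+ t :* (b :* y))
                         refl (b ℓ) s t (f (e ℓ)) (g (e ℓ))

solution-Λ-vanishes : ∀ u v K N a b → lhs u v K N a ≐ rhs u v K N b →
                      ∀ q → DegBelow K q → Λ u v K N b q ≡ 0ℚ
solution-Λ-vanishes u v K N a b solution q deg =
  trans (sym (pair-rhs u v K N b q))
    (trans (sym (pair-≐ q {lhs u v K N a} {rhs u v K N b} solution)) (pair-lhs-vanishes u v K N a q deg))

-- Uniqueness of the coefficients b_ℓ.

lagrange : (ℕ → ℚ) → ℕ → ℕ → ℕ → ℚ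
lagrange r ℓ zero    i = 1ℚ
lagrange r ℓ (suc K) i with suc K ℕ.≟ ℓ
... | yes _ = lagrange r ℓ K i
... | no  _ = (ℕ→ℚ i - r (suc K)) * lagrange r ℓ K i

lagrange-deg : ∀ r ℓ K → DegBelow (suc K) (lagrange r ℓ K)
lagrange-deg r ℓ zero    = DegBelow-one
lagrange-deg r ℓ (suc K) with suc K ℕ.≟ ℓ
... | yes _ = DegBelow-suc (suc K) (lagrange r ℓ K) (lagrange-deg r ℓ K)
... | no  _ = DegBelow-linearFactor (suc K) (r (suc K)) (lagrange r ℓ K) (lagrange-deg r ℓ K)

lagrange-deg-skip : ∀ r ℓ K → 1 ≤ ℓ → ℓ ≤ K → DegBelow K (lagrange r ℓ K)
lagrange-deg-skip r ℓ zero    1≤ℓ ℓ≤0 with () ← ℕP.≤-trans 1≤ℓ ℓ≤0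
lagrange-deg-skip r ℓ (suc K) 1≤ℓ ℓ≤K with suc K ℕ.≟ ℓ
... | yes _   = lagrange-deg r ℓ K
... | no  K≢ℓ = DegBelow-linearFactor K (r (suc K)) (lagrange r ℓ K)
                  (lagrange-deg-skip r ℓ K 1≤ℓ (ℕP.≤-pred (ℕP.≤∧≢⇒< ℓ≤K (λ e → K≢ℓ (sym e)))))

lagrange-root : ∀ r ℓ K j i → 1 ≤ j → j ≤ K → j ≢ ℓ → r j ≡ ℕ→ℚ i →
                lagrange r ℓ K i ≡ 0ℚ
lagrange-root r ℓ zero    j i 1≤j j≤0 j≢ℓ rj≡i with () ← ℕP.≤-trans 1≤j j≤0
lagrange-root r ℓ (suc K) j i 1≤j j≤K j≢ℓ rj≡i with suc K ℕ.≟ ℓ | j ℕ.≟ suc K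
... | yes K≡ℓ | yes j≡K = ⊥-elim (j≢ℓ (trans j≡K K≡ℓ))
... | no  _   | yes refl =
  trans (cong (λ t → (ℕ→ℚ i - t) * lagrange r ℓ K i) rj≡i)
        (trans (cong (_* lagrange r ℓ K i) (ℚP.+-inverseʳ (ℕ→ℚ i))) (ℚP.*-zeroˡ (lagrange r ℓ K i)))
... | yes _   | no  j≢K = lagrange-root r ℓ K j i 1≤j (ℕP.≤-pred (ℕP.≤∧≢⇒< j≤K j≢K)) j≢ℓ rj≡i
... | no  _   | no  j≢K =
  trans (cong ((ℕ→ℚ i - r (suc K)) *_) (lagrange-root r ℓ K j i 1≤j (ℕP.≤-pred (ℕP.≤∧≢⇒< j≤K j≢K)) j≢ℓ rj≡i))
        (ℚP.*-zeroʳ (ℕ→ℚ i - r (suc K)))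

lagrange-nonzero : ∀ r ℓ K i → (∀ j → 1 ≤ j → j ≤ K → j ≢ ℓ → r j ≢ ℕ→ℚ i) →
                   lagrange r ℓ K i ≢ 0ℚ
lagrange-nonzero r ℓ zero    i h = λ ()
lagrange-nonzero r ℓ (suc K) i h with suc K ℕ.≟ ℓ
... | yes _   = lagrange-nonzero r ℓ K i h'
  where h' = λ j a b → h j a (ℕP.m≤n⇒m≤1+n b)
... | no  K≢ℓ = λ prod≡0 → lagrange-nonzero r ℓ K i h'
                  (≢0-*-zero (ℕ→ℚ i - r (suc K)) (lagrange r ℓ K i) factor≢0 prod≡0)
  where
  h' = λ j a b → h j a (ℕP.m≤n⇒m≤1+n b)
  factor≢0 : ℕ→ℚ i - r (suc K) ≢ 0ℚ
  factor≢0 e = h (suc K) (s≤s z≤n) ℕP.≤-refl K≢ℓ (sym (x∙y⁻¹≈ε⇒x≈y (ℕ→ℚ i) (r (suc K)) e))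

expo-injective : ∀ u v N j j' → u < v → 1 ≤ j → 1 ≤ j' → expo u v N j ≡ expo u v N j' → j ≡ j'
expo-injective u v N (suc j) (suc j') u<v _ _ e = ℕP.*-cancelʳ-≡ (suc j) (suc j') v {{v≢0}} jv≡j'v
  where
  v≢0 : ℕ.NonZero v
  v≢0 = ℕ.>-nonZero (ℕP.<-≤-trans (s≤s z≤n) u<v)
  u≤ : ∀ k → u ≤ suc k ℕ.* v
  u≤ k = ℕP.≤-trans (ℕP.<⇒≤ u<v) (ℕP.m≤m+n v (k ℕ.* v))
  jv≡j'v : suc j ℕ.* v ≡ suc j' ℕ.* v
  jv≡j'v = trans (sym (ℕP.m∸n+n≡m (u≤ j)))
    (trans (cong (ℕ._+ u) (ℕP.+-cancelˡ-≡ (N ℕ.* v) _ _ e)) (ℕP.m∸n+n≡m (u≤ j')))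

-- If two coefficient families induce the same functional on all sequences of
-- degree < K, they agree on 1 ≤ ℓ ≤ K: test against lagrange with nodes e_j.
coefficients-determined : ∀ u v K N b b' → u < v →
  (∀ q → DegBelow K q → Λ u v K N b q ≡ Λ u v K N b' q) →
  ∀ ℓ → 1 ≤ ℓ → ℓ ≤ K → b ℓ ≡ b' ℓ
coefficients-determined u v K N b b' u<v same ℓ 1≤ℓ ℓ≤K =
  *-cancelʳ-≢0 (q eℓ) (b ℓ) (b' ℓ) q[eℓ]≢0 (∙-cancelˡ (q 0) _ _ Λ-isolated)
  where
  e = expo u v N
  eℓ = e ℓ
  q = lagrange (λ j → ℕ→ℚ (e j)) ℓ K
  q[eℓ]≢0 : q eℓ ≢ 0ℚ
  q[eℓ]≢0 = lagrange-nonzero _ ℓ K eℓ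
    (λ j 1≤j _ j≢ℓ ej≡eℓ → j≢ℓ (expo-injective u v N j ℓ u<v 1≤j 1≤ℓ (ℕ→ℚ-injective _ _ ej≡eℓ)))
  isolate : ∀ c → Σ₁ K (λ j → c j * q (e j)) ≡ c ℓ * q eℓ
  isolate c = Σ₁-single K ℓ _ 1≤ℓ ℓ≤K (λ j 1≤j j≤K j≢ℓ →
    trans (cong (c j *_) (lagrange-root _ ℓ K j (e j) 1≤j j≤K j≢ℓ refl)) (ℚP.*-zeroʳ (c j)))
  Λ-isolated : q 0 + b ℓ * q eℓ ≡ q 0 + b' ℓ * q eℓ
  Λ-isolated = trans (cong (λ r → q 0 + r) (sym (isolate b)))
    (trans (same q (lagrange-deg-skip _ ℓ K 1≤ℓ ℓ≤K)) (cong (λ r → q 0 + r) (isolate b')))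

-- Taylor expansion at X = 1.

pair-ext : ∀ p p' → (∀ q → ⟪ q ∣ p ⟫ ≡ ⟪ q ∣ p' ⟫) → p ≐ p'
pair-ext p p' h k = trans (sym (pair-δ k p)) (trans (h (δ k)) (pair-δ k p'))

-- The binomial sequences: binom j i = (i choose j), built by partial sums.
binom : ℕ → ℕ → ℚ
binom zero      = one
binom (suc j) i = Σ< i (binom j)

-- Synthetic division by X - 1: the quotient of Σ pᵢ Xⁱ has k-th coefficient
-- Σ_{i>k} pᵢ, and the remainder is p(1) = ⟪ one ∣ p ⟫.
divXm1 : Poly → Poly
divXm1 []      = []
divXm1 (c ∷ p) = ⟪ one ∣ p ⟫ ∷ divXm1 p

divXm1^ : ℕ → Poly → Poly
divXm1^ zero    p = p
divXm1^ (suc m) p = divXm1 (divXm1^ m p)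

pair-divXm1 : ∀ q p → ⟪ q ∣ divXm1 p ⟫ ≡ ⟪ (λ i → Σ< i q) ∣ p ⟫
pair-divXm1 q []      = refl
pair-divXm1 q (c ∷ p) = begin
  ⟪ one ∣ p ⟫ * q 0 + ⟪ shift q ∣ divXm1 p ⟫
    ≡⟨ cong (λ r → ⟪ one ∣ p ⟫ * q 0 + r) (pair-divXm1 (shift q) p) ⟩
  ⟪ one ∣ p ⟫ * q 0 + ⟪ (λ i → Σ< i (shift q)) ∣ p ⟫
    ≡⟨ solve 3 (λ c P S → P :* c :+ S := c :* P :+ con 1ℚ :* S :+ con 0ℚ)
              refl (q 0) ⟪ one ∣ p ⟫ ⟪ (λ i → Σ< i (shift q)) ∣ p ⟫ ⟩
  q 0 * ⟪ one ∣ p ⟫ + 1ℚ * ⟪ (λ i → Σ< i (shift q)) ∣ p ⟫ + 0ℚ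
    ≡⟨ cong₂ _+_ (sym (pair-linear (q 0) 1ℚ one _ p)) (sym (ℚP.*-zeroʳ c)) ⟩
  ⟪ (λ i → q 0 * 1ℚ + 1ℚ * Σ< i (shift q)) ∣ p ⟫ + c * 0ℚ
    ≡⟨ cong (_+ c * 0ℚ) (pair-cong p (λ i → sym (front i))) ⟩
  ⟪ (λ i → Σ< (suc i) q) ∣ p ⟫ + c * 0ℚ
    ≡⟨ ℚP.+-comm _ (c * 0ℚ) ⟩
  c * 0ℚ + ⟪ (λ i → Σ< (suc i) q) ∣ p ⟫ ∎
  where
  open ≡-Reasoning
  front : ∀ i → Σ< (suc i) q ≡ q 0 * 1ℚ + 1ℚ * Σ< i (shift q)
  front i = trans (Σ<-front i q)
    (solve 2 (λ x S → x :+ S := x :* con 1ℚ :+ con 1ℚ :* S) refl (q 0) (Σ< i (shift q)))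

pair-binom-divXm1^ : ∀ m j p → ⟪ binom j ∣ divXm1^ m p ⟫ ≡ ⟪ binom (m ℕ.+ j) ∣ p ⟫
pair-binom-divXm1^ zero    j p = refl
pair-binom-divXm1^ (suc m) j p =
  trans (pair-divXm1 (binom j) (divXm1^ m p))
    (trans (pair-binom-divXm1^ m (suc j) p) (cong (λ n → ⟪ binom n ∣ p ⟫) (ℕP.+-suc m j)))

Σ<-telescope : ∀ r i → Σ< i (Δ r) ≡ r i - r 0
Σ<-telescope r zero    = sym (ℚP.+-inverseʳ (r 0))
Σ<-telescope r (suc i) = trans (cong (_+ Δ r i) (Σ<-telescope r i))
  (solve 3 (λ a b c → (a :- c) :+ (b :- a) := b :- c) refl (r i) (r (suc i)) (r 0))

-- Summation by parts: Q = Q(1) + (X - 1) (Q div (X - 1)), seen through the pairing.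
summation-by-parts : ∀ r Q → ⟪ r ∣ Q ⟫ ≡ r 0 * ⟪ one ∣ Q ⟫ + ⟪ Δ r ∣ divXm1 Q ⟫
summation-by-parts r Q = sym (begin
  r 0 * ⟪ one ∣ Q ⟫ + ⟪ Δ r ∣ divXm1 Q ⟫
    ≡⟨ cong (λ t → r 0 * ⟪ one ∣ Q ⟫ + t) (pair-divXm1 (Δ r) Q) ⟩
  r 0 * ⟪ one ∣ Q ⟫ + ⟪ (λ i → Σ< i (Δ r)) ∣ Q ⟫
    ≡⟨ cong (λ t → r 0 * ⟪ one ∣ Q ⟫ + t) (pair-cong Q telescoped) ⟩
  r 0 * ⟪ one ∣ Q ⟫ + ⟪ (λ i → 1ℚ * r i + (- r 0) * 1ℚ) ∣ Q ⟫
    ≡⟨ cong (λ t → r 0 * ⟪ one ∣ Q ⟫ + t) (pair-linear 1ℚ (- r 0) r one Q) ⟩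
  r 0 * ⟪ one ∣ Q ⟫ + (1ℚ * ⟪ r ∣ Q ⟫ + (- r 0) * ⟪ one ∣ Q ⟫)
    ≡⟨ solve 3 (λ x O P → x :* O :+ (con 1ℚ :* P :+ (:- x) :* O) := P)
             refl (r 0) ⟪ one ∣ Q ⟫ ⟪ r ∣ Q ⟫ ⟩
  ⟪ r ∣ Q ⟫ ∎)
  where
  open ≡-Reasoning
  telescoped : ∀ i → Σ< i (Δ r) ≡ 1ℚ * r i + (- r 0) * 1ℚ
  telescoped i = trans (Σ<-telescope r i)
    (solve 2 (λ a b → a :- b := con 1ℚ :* a :+ (:- b) :* con 1ℚ) refl (r i) (r 0))

VanishFrom : ℕ → Poly → Set
VanishFrom n p = ∀ k → n ≤ k → coeff p k ≡ 0ℚ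

divXm1-vanish : ∀ n p → VanishFrom (suc n) p → VanishFrom n (divXm1 p)
divXm1-vanish n       []      h k       _         = refl
divXm1-vanish zero    (c ∷ p) h zero    _         = pair-null one p (λ k → sym (h (suc k) (s≤s z≤n)))
divXm1-vanish zero    (c ∷ p) h (suc k) _         = divXm1-vanish zero p (λ k' _ → h (suc k') (s≤s z≤n)) k z≤n
divXm1-vanish (suc n) (c ∷ p) h (suc k) (s≤s n≤k) = divXm1-vanish n p (λ k' le → h (suc k') (s≤s le)) k n≤k

divXm1^-vanish : ∀ m t p → VanishFrom (m ℕ.+ t) p → VanishFrom t (divXm1^ m p)
divXm1^-vanish zero    t p h = h
divXm1^-vanish (suc m) t p h = divXm1-vanish t (divXm1^ m p)
  (divXm1^-vanish m (suc t) p (subst (λ n → VanishFrom n p) (sym (ℕP.+-suc m t)) h))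

-- The Taylor expansion of P at 1: a m = Σᵢ pᵢ (i choose m) is the coefficient of (X - 1)ᵐ.
module TaylorExpansion (P : Poly) where

  a : ℕ → ℚ
  a m = ⟪ binom m ∣ P ⟫

  R : ℕ → Poly
  R m = divXm1^ m P

  remainder : ∀ m → ⟪ one ∣ R m ⟫ ≡ a m
  remainder m = trans (pair-binom-divXm1^ m 0 P) (cong (λ n → ⟪ binom n ∣ P ⟫) (ℕP.+-identityʳ m))

  step : ∀ q m → ⟪ Δ^ m q ∣ R m ⟫ ≡ a m * Δ^ m q 0 + ⟪ Δ^ (suc m) q ∣ R (suc m) ⟫
  step q m = trans (summation-by-parts (Δ^ m q) (R m))
    (cong₂ _+_ (trans (cong (Δ^ m q 0 *_) (remainder m)) (ℚP.*-comm (Δ^ m q 0) (a m)))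
               (pair-cong (R (suc m)) (λ i → sym (Δ^-Δ m q i))))

  descend : ∀ K → (∀ j → j < K → a j ≡ 0ℚ) → ∀ q j → j ≤ K → ⟪ q ∣ P ⟫ ≡ ⟪ Δ^ j q ∣ R j ⟫
  descend K low q zero    _    = refl
  descend K low q (suc j) j<K = begin
    ⟪ q ∣ P ⟫
      ≡⟨ descend K low q j (ℕP.<⇒≤ j<K) ⟩
    ⟪ Δ^ j q ∣ R j ⟫
      ≡⟨ step q j ⟩
    a j * Δ^ j q 0 + ⟪ Δ^ (suc j) q ∣ R (suc j) ⟫
      ≡⟨ cong (λ c → c * Δ^ j q 0 + ⟪ Δ^ (suc j) q ∣ R (suc j) ⟫) (low j j<K) ⟩
    0ℚ * Δ^ j q 0 + ⟪ Δ^ (suc j) q ∣ R (suc j) ⟫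
      ≡⟨ solve 2 (λ x y → con 0ℚ :* x :+ y := y) refl (Δ^ j q 0) _ ⟩
    ⟪ Δ^ (suc j) q ∣ R (suc j) ⟫ ∎
    where open ≡-Reasoning

  expand : ∀ q t m → ⟪ Δ^ m q ∣ R m ⟫
                     ≡ Σ< t (λ i → a (i ℕ.+ m) * Δ^ (i ℕ.+ m) q 0) + ⟪ Δ^ (t ℕ.+ m) q ∣ R (t ℕ.+ m) ⟫
  expand q zero    m = sym (ℚP.+-identityˡ _)
  expand q (suc t) m = trans (expand q t m)
    (trans (cong (λ r → S + r) (step q (t ℕ.+ m)))
           (sym (ℚP.+-assoc S (a (t ℕ.+ m) * Δ^ (t ℕ.+ m) q 0) ⟪ Δ^ (suc t ℕ.+ m) q ∣ R (suc t ℕ.+ m) ⟫)))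
    where S = Σ< t (λ i → a (i ℕ.+ m) * Δ^ (i ℕ.+ m) q 0)

  expansion : ∀ D K → VanishFrom (suc D) P → (∀ j → j < K → a j ≡ 0ℚ) → K ≤ suc D →
              ∀ q → ⟪ q ∣ P ⟫ ≡ Σ< (suc D ∸ K) (λ i → a (K ℕ.+ i) * Δ^ (K ℕ.+ i) q 0)
  expansion D K deg low K≤ q = begin
    ⟪ q ∣ P ⟫
      ≡⟨ descend K low q K ℕP.≤-refl ⟩
    ⟪ Δ^ K q ∣ R K ⟫
      ≡⟨ expand q t K ⟩
    Σ< t (λ i → a (i ℕ.+ K) * Δ^ (i ℕ.+ K) q 0) + ⟪ Δ^ (t ℕ.+ K) q ∣ R (t ℕ.+ K) ⟫
      ≡⟨ cong₂ _+_ (Σ<-cong t (λ i _ → cong (λ n → a n * Δ^ n q 0) (ℕP.+-comm i K)))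
                   (pair-null _ (R (t ℕ.+ K)) (λ k → sym (quotient-vanishes k z≤n))) ⟩
    Σ< t (λ i → a (K ℕ.+ i) * Δ^ (K ℕ.+ i) q 0) + 0ℚ
      ≡⟨ ℚP.+-identityʳ _ ⟩
    Σ< t (λ i → a (K ℕ.+ i) * Δ^ (K ℕ.+ i) q 0) ∎
    where
    open ≡-Reasoning
    t = suc D ∸ K
    quotient-vanishes : VanishFrom 0 (R (t ℕ.+ K))
    quotient-vanishes = divXm1^-vanish (t ℕ.+ K) 0 P
      (subst (λ n → VanishFrom n P) (sym (trans (ℕP.+-identityʳ _) (ℕP.m∸n+n≡m K≤))) deg)

-- The closed formula, factored as  bFormula u v K N ℓ = weight K ℓ * ∏≠ K ℓ (node N),
-- with weight K ℓ = (-1)^ℓ / ((ℓ-1)! (K-ℓ)!) and node N j = j + N - u/v.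

sign : ℕ → ℤ
sign ℓ = -[1+ 0 ] ℤ.^ ℓ

fact : ℕ → ℕ → ℕ
fact K ℓ = (ℓ ∸ 1) ! ℕ.* (K ∸ ℓ) !

fact-nonZero : ∀ K ℓ → ℕ.NonZero (fact K ℓ)
fact-nonZero K ℓ = (ℓ ∸ 1) ℕP.!* (K ∸ ℓ) !≢0

weight : ℕ → ℕ → ℚ
weight K ℓ = (sign ℓ / fact K ℓ) {{fact-nonZero K ℓ}}

weight-spec : ∀ K ℓ → weight K ℓ * ℕ→ℚ (fact K ℓ) ≡ ℤ→ℚ (sign ℓ)
weight-spec K ℓ = /-*-inverse (sign ℓ) (fact K ℓ) {{fact-nonZero K ℓ}}

weight-rescale : ∀ K ℓ K' ℓ' n → n ℕ.* fact K ℓ ≡ fact K' ℓ' →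
                 (weight K' ℓ' * ℕ→ℚ n) * ℕ→ℚ (fact K ℓ) ≡ ℤ→ℚ (sign ℓ')
weight-rescale K ℓ K' ℓ' n n*f≡f' = begin
  (weight K' ℓ' * ℕ→ℚ n) * ℕ→ℚ (fact K ℓ) ≡⟨ ℚP.*-assoc (weight K' ℓ') (ℕ→ℚ n) (ℕ→ℚ (fact K ℓ)) ⟩
  weight K' ℓ' * (ℕ→ℚ n * ℕ→ℚ (fact K ℓ)) ≡⟨ cong (weight K' ℓ' *_) (sym (ℕ→ℚ-* n (fact K ℓ))) ⟩
  weight K' ℓ' * ℕ→ℚ (n ℕ.* fact K ℓ)     ≡⟨ cong (λ m → weight K' ℓ' * ℕ→ℚ m) n*f≡f' ⟩
  weight K' ℓ' * ℕ→ℚ (fact K' ℓ')         ≡⟨ weight-spec K' ℓ' ⟩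
  ℤ→ℚ (sign ℓ')                          ∎
  where open ≡-Reasoning

fact≢0 : ∀ K ℓ → ℕ→ℚ (fact K ℓ) ≢ 0ℚ
fact≢0 K ℓ = ℕ→ℚ-nonZero (fact K ℓ) {{fact-nonZero K ℓ}}

weight-raiseK : ∀ K ℓ → ℓ ≤ K → weight (suc K) ℓ * ℕ→ℚ (suc K ∸ ℓ) ≡ weight K ℓ
weight-raiseK K ℓ ℓ≤K = *-cancelʳ-≢0 (ℕ→ℚ (fact K ℓ)) _ _ (fact≢0 K ℓ)
  (trans (weight-rescale K ℓ (suc K) ℓ (suc K ∸ ℓ) factorials) (sym (weight-spec K ℓ)))
  where
  factorials : (suc K ∸ ℓ) ℕ.* fact K ℓ ≡ fact (suc K) ℓ
  K+1-ℓ : suc K ∸ ℓ ≡ suc (K ∸ ℓ)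
  K+1-ℓ = ℕP.+-∸-assoc 1 ℓ≤K
  factorials = trans (cong (ℕ._* fact K ℓ) K+1-ℓ)
    (trans (x∙yz≈y∙xz (suc (K ∸ ℓ)) ((ℓ ∸ 1) !) ((K ∸ ℓ) !)) (cong (λ m → (ℓ ∸ 1) ! ℕ.* m !) (sym K+1-ℓ)))

weight-raiseℓ : ∀ K ℓ → 1 ≤ ℓ → weight (suc K) (suc ℓ) * ℕ→ℚ ℓ ≡ - weight K ℓ
weight-raiseℓ K (suc ℓ) _ = *-cancelʳ-≢0 (ℕ→ℚ (fact K (suc ℓ))) _ _ (fact≢0 K (suc ℓ)) (begin
  (weight (suc K) (suc (suc ℓ)) * ℕ→ℚ (suc ℓ)) * ℕ→ℚ (fact K (suc ℓ))
      ≡⟨ weight-rescale K (suc ℓ) (suc K) (suc (suc ℓ)) (suc ℓ) (sym (ℕP.*-assoc (suc ℓ) (ℓ !) ((K ∸ suc ℓ) !))) ⟩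
  ℤ→ℚ (sign (suc (suc ℓ)))
    ≡⟨ cong ℤ→ℚ (ℤP.-1*i≡-i (sign (suc ℓ))) ⟩
  ℤ→ℚ (ℤ.- sign (suc ℓ))
    ≡⟨ ℤ→ℚ-neg (sign (suc ℓ)) ⟩
  - ℤ→ℚ (sign (suc ℓ))
    ≡⟨ cong -_ (sym (weight-spec K (suc ℓ))) ⟩
  - (weight K (suc ℓ) * ℕ→ℚ (fact K (suc ℓ)))
    ≡⟨ ℚP.neg-distribˡ-* (weight K (suc ℓ)) (ℕ→ℚ (fact K (suc ℓ))) ⟩
  - weight K (suc ℓ) * ℕ→ℚ (fact K (suc ℓ)) ∎)
  where open ≡-Reasoning

without : ℕ → List ℕ → List ℕ
without ℓ = filter (λ j → ¬? (j ℕ.≟ ℓ))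

∏≠ : ℕ → ℕ → (ℕ → ℚ) → ℚ
∏≠ K ℓ f = prodℚ (without ℓ (range 1 K)) f

prodℚ-++ : ∀ xs ys f → prodℚ (xs ++ ys) f ≡ prodℚ xs f * prodℚ ys f
prodℚ-++ []       ys f = sym (ℚP.*-identityˡ _)
prodℚ-++ (x ∷ xs) ys f = trans (cong (f x *_) (prodℚ-++ xs ys f))
                               (sym (ℚP.*-assoc (f x) (prodℚ xs f) (prodℚ ys f)))

prodℚ-cong : ∀ xs {f g} → (∀ j → f j ≡ g j) → prodℚ xs f ≡ prodℚ xs g
prodℚ-cong []       f≗g = refl
prodℚ-cong (x ∷ xs) f≗g = cong₂ _*_ (f≗g x) (prodℚ-cong xs f≗g)

prodℚ-without-suc : ∀ ℓ xs f → prodℚ (without (suc ℓ) (map suc xs)) f ≡ prodℚ (without ℓ xs) (shift f)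
prodℚ-without-suc ℓ []       f = refl
prodℚ-without-suc ℓ (x ∷ xs) f with x ℕ.≡ᵇ ℓ
... | true  = prodℚ-without-suc ℓ xs f
... | false = cong (f (suc x) *_) (prodℚ-without-suc ℓ xs f)

range1-snoc : ∀ K → range 1 (suc K) ≡ range 1 K ++ (suc K ∷ [])
range1-snoc K = trans (cong (map suc) (sym (LP.applyUpTo-∷ʳ (λ x → x) K))) (LP.map-++ suc (upTo K) (K ∷ []))

range1-cons : ∀ K → range 1 (suc K) ≡ 1 ∷ map suc (range 1 K)
range1-cons K = cong (1 ∷_) (trans (LP.map-applyUpTo suc suc K)
  (sym (trans (cong (map suc) (LP.map-applyUpTo (λ x → x) suc K)) (LP.map-applyUpTo suc suc K))))

∏≠-snoc : ∀ K ℓ f → ℓ ≤ K → ∏≠ (suc K) ℓ f ≡ ∏≠ K ℓ f * f (suc K)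
∏≠-snoc K ℓ f ℓ≤K = begin
  prodℚ (without ℓ (range 1 (suc K))) f
    ≡⟨ cong (λ xs → prodℚ (without ℓ xs) f) (range1-snoc K) ⟩
  prodℚ (without ℓ (range 1 K ++ (suc K ∷ []))) f
    ≡⟨ cong (λ xs → prodℚ xs f) (LP.filter-++ (λ j → ¬? (j ℕ.≟ ℓ)) (range 1 K) _) ⟩
  prodℚ (without ℓ (range 1 K) ++ without ℓ (suc K ∷ [])) f
    ≡⟨ prodℚ-++ (without ℓ (range 1 K)) _ f ⟩
  ∏≠ K ℓ f * prodℚ (without ℓ (suc K ∷ [])) f
    ≡⟨ cong (λ xs → ∏≠ K ℓ f * prodℚ xs f)
         (LP.filter-accept (λ j → ¬? (j ℕ.≟ ℓ)) (λ K≡ℓ → ℕP.<-irrefl (sym K≡ℓ) (s≤s ℓ≤K))) ⟩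
  ∏≠ K ℓ f * (f (suc K) * 1ℚ)
    ≡⟨ cong (∏≠ K ℓ f *_) (ℚP.*-identityʳ (f (suc K))) ⟩
  ∏≠ K ℓ f * f (suc K) ∎
  where open ≡-Reasoning

∏≠-cons : ∀ K ℓ f → 1 ≤ ℓ → ∏≠ (suc K) (suc ℓ) f ≡ f 1 * ∏≠ K ℓ (shift f)
∏≠-cons K (suc ℓ) f _ = trans (cong (λ xs → prodℚ (without (suc (suc ℓ)) xs) f) (range1-cons K))
                              (cong (f 1 *_) (prodℚ-without-suc (suc ℓ) (range 1 K) f))

module ClosedFormula (u v : ℕ) where

  node : ℕ → ℕ → ℚ
  node N j = ℕ→ℚ (j ℕ.+ N) - fracℕ u v

  b : ℕ → ℕ → ℕ → ℚ
  b K N = bFormula u v K N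

  node-diff : ∀ N j k → node N j - node N k ≡ ℕ→ℚ j - ℕ→ℚ k
  node-diff N j k = trans (cong₂ (λ s t → (s - fracℕ u v) - (t - fracℕ u v)) (ℕ→ℚ-+ j N) (ℕ→ℚ-+ k N))
    (solve 4 (λ a b n f → ((a :+ n) :- f) :- ((b :+ n) :- f) := a :- b)
             refl (ℕ→ℚ j) (ℕ→ℚ k) (ℕ→ℚ N) (fracℕ u v))

  b-raiseK : ∀ K N ℓ → ℓ ≤ K → b (suc K) N ℓ * ℕ→ℚ (suc K ∸ ℓ) ≡ node N (suc K) * b K N ℓ
  b-raiseK K N ℓ ℓ≤K = begin
    (weight (suc K) ℓ * ∏≠ (suc K) ℓ (node N)) * s
      ≡⟨ cong (λ t → (weight (suc K) ℓ * t) * s) (∏≠-snoc K ℓ (node N) ℓ≤K) ⟩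
    (weight (suc K) ℓ * (∏≠ K ℓ (node N) * c)) * s
      ≡⟨ solve 4 (λ w P c s → (w :* (P :* c)) :* s := c :* ((w :* s) :* P))
                 refl (weight (suc K) ℓ) (∏≠ K ℓ (node N)) c s ⟩
    c * ((weight (suc K) ℓ * s) * ∏≠ K ℓ (node N))
      ≡⟨ cong (λ t → c * (t * ∏≠ K ℓ (node N))) (weight-raiseK K ℓ ℓ≤K) ⟩
    c * (weight K ℓ * ∏≠ K ℓ (node N)) ∎
    where
    open ≡-Reasoning
    s = ℕ→ℚ (suc K ∸ ℓ)
    c = node N (suc K)

  b-raiseℓ : ∀ K N ℓ → 1 ≤ ℓ → b (suc K) N (suc ℓ) * ℕ→ℚ ℓ ≡ - (node N 1 * b K (suc N) ℓ)
  b-raiseℓ K N ℓ 1≤ℓ = begin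
    (weight (suc K) (suc ℓ) * ∏≠ (suc K) (suc ℓ) (node N)) * l
      ≡⟨ cong (λ t → (weight (suc K) (suc ℓ) * t) * l) shifted ⟩
    (weight (suc K) (suc ℓ) * (c * P)) * l
      ≡⟨ solve 4 (λ w P c l → (w :* (c :* P)) :* l := (w :* l) :* (c :* P))
                 refl (weight (suc K) (suc ℓ)) P c l ⟩
    (weight (suc K) (suc ℓ) * l) * (c * P)
      ≡⟨ cong (_* (c * P)) (weight-raiseℓ K ℓ 1≤ℓ) ⟩
    (- weight K ℓ) * (c * P)
      ≡⟨ solve 3 (λ w P c → (:- w) :* (c :* P) := :- (c :* (w :* P)))
                 refl (weight K ℓ) P c ⟩
    - (c * (weight K ℓ * P)) ∎
    where
    open ≡-Reasoning
    l = ℕ→ℚ ℓ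
    c = node N 1
    P = ∏≠ K ℓ (node (suc N))
    shifted : ∏≠ (suc K) (suc ℓ) (node N) ≡ c * P
    shifted = trans (∏≠-cons K ℓ (node N) 1≤ℓ)
      (cong (c *_) (prodℚ-cong (without ℓ (range 1 K))
                                (λ j → cong (λ n → ℕ→ℚ n - fracℕ u v) (sym (ℕP.+-suc j N)))))

Σ<-one : ∀ i → Σ< i one ≡ ℕ→ℚ i
Σ<-one zero    = refl
Σ<-one (suc i) = trans (cong (_+ 1ℚ) (Σ<-one i)) (trans (ℚP.+-comm (ℕ→ℚ i) 1ℚ) (sym (ℕ→ℚ-suc i)))

pascal-step : ∀ i i+1 j j+1 j+2 (C₀ C₁ C₂ : ℚ) → i+1 ≡ 1ℚ + i → j+1 ≡ 1ℚ + j → j+2 ≡ 1ℚ + j+1 →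
              i * C₁ ≡ j+2 * C₂ + j+1 * C₁ → i * C₀ ≡ j+1 * C₁ + j * C₀ →
              i+1 * (C₁ + C₀) ≡ j+2 * (C₂ + C₁) + j+1 * (C₁ + C₀)
pascal-step i _ j _ _ C₀ C₁ C₂ refl refl refl iC₁ iC₀ = begin
  (1ℚ + i) * (C₁ + C₀)
    ≡⟨ solve 3 (λ i C₀ C₁ → (con 1ℚ :+ i) :* (C₁ :+ C₀) := C₁ :+ C₀ :+ (i :* C₁ :+ i :* C₀))
                refl i C₀ C₁ ⟩
  C₁ + C₀ + (i * C₁ + i * C₀)
    ≡⟨ cong₂ (λ x y → C₁ + C₀ + (x + y)) iC₁ iC₀ ⟩
  C₁ + C₀ + ((1ℚ + (1ℚ + j)) * C₂ + (1ℚ + j) * C₁ + ((1ℚ + j) * C₁ + j * C₀))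
    ≡⟨ solve 4 (λ j C₀ C₁ C₂ → let j+1 = con 1ℚ :+ j; j+2 = con 1ℚ :+ j+1 in
                  C₁ :+ C₀ :+ (j+2 :* C₂ :+ j+1 :* C₁ :+ (j+1 :* C₁ :+ j :* C₀))
                  := j+2 :* (C₂ :+ C₁) :+ j+1 :* (C₁ :+ C₀))
               refl j C₀ C₁ C₂ ⟩
  (1ℚ + (1ℚ + j)) * (C₂ + C₁) + (1ℚ + j) * (C₁ + C₀) ∎
  where open ≡-Reasoning

pascal : ∀ i j → ℕ→ℚ i * binom j i ≡ ℕ→ℚ (suc j) * binom (suc j) i + ℕ→ℚ j * binom j i
pascal zero    zero    = refl
pascal zero    (suc j) = solve 2 (λ x y → con 0ℚ :* con 0ℚ := x :* con 0ℚ :+ y :* con 0ℚ)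
                                 refl (ℕ→ℚ (suc (suc j))) (ℕ→ℚ (suc j))
pascal (suc i) zero    = trans (ℚP.*-identityʳ _) (trans (sym (Σ<-one (suc i)))
  (solve 1 (λ x → x := con 1ℚ :* x :+ con 0ℚ :* con 1ℚ) refl (Σ< (suc i) one)))
pascal (suc i) (suc j) = pascal-step (ℕ→ℚ i) (ℕ→ℚ (suc i)) (ℕ→ℚ j) (ℕ→ℚ (suc j)) (ℕ→ℚ (suc (suc j)))
  (binom j i) (binom (suc j) i) (binom (suc (suc j)) i)
  (ℕ→ℚ-suc i) (ℕ→ℚ-suc j) (ℕ→ℚ-suc (suc j)) (pascal i (suc j)) (pascal i j)

module Vanishing (u v′ : ℕ) (u<v : u < suc v′) where

  v : ℕ
  v = suc v′

  open ClosedFormula u v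

  V : ℚ
  V = ℕ→ℚ v

  e : ℕ → ℕ → ℚ
  e N ℓ = ℕ→ℚ (expo u v N ℓ)

  Λᵇ : ℕ → ℕ → (ℕ → ℚ) → ℚ
  Λᵇ K N = Λ u v K N (b K N)

  u≤ℓv : ∀ ℓ → 1 ≤ ℓ → u ≤ ℓ ℕ.* v
  u≤ℓv (suc ℓ) _ = ℕP.≤-trans (ℕP.<⇒≤ u<v) (ℕP.m≤m+n v (ℓ ℕ.* v))

  e≡V*node : ∀ N ℓ → 1 ≤ ℓ → e N ℓ ≡ V * node N ℓ
  e≡V*node N ℓ 1≤ℓ = begin
    ℕ→ℚ (N ℕ.* v ℕ.+ (ℓ ℕ.* v ∸ u))
      ≡⟨ ℕ→ℚ-+ (N ℕ.* v) _ ⟩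
    ℕ→ℚ (N ℕ.* v) + ℕ→ℚ (ℓ ℕ.* v ∸ u)
      ≡⟨ cong₂ _+_ (ℕ→ℚ-* N v) (ℕ→ℚ-∸ (ℓ ℕ.* v) u (u≤ℓv ℓ 1≤ℓ)) ⟩
    ℕ→ℚ N * V + (ℕ→ℚ (ℓ ℕ.* v) - ℕ→ℚ u)
      ≡⟨ cong₂ (λ s t → ℕ→ℚ N * V + (s - t)) (ℕ→ℚ-* ℓ v) (sym (/-*-inverse (+ u) v)) ⟩
    ℕ→ℚ N * V + (ℕ→ℚ ℓ * V - fracℕ u v * V)
      ≡⟨ solve 4 (λ n l V f → n :* V :+ (l :* V :- f :* V) := V :* ((l :+ n) :- f))
                 refl (ℕ→ℚ N) (ℕ→ℚ ℓ) V (fracℕ u v) ⟩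
    V * ((ℕ→ℚ ℓ + ℕ→ℚ N) - fracℕ u v)
      ≡⟨ cong (λ t → V * (t - fracℕ u v)) (sym (ℕ→ℚ-+ ℓ N)) ⟩
    V * node N ℓ ∎
    where open ≡-Reasoning

  e-diff : ∀ N j k → 1 ≤ j → 1 ≤ k → e N j - e N k ≡ V * (ℕ→ℚ j - ℕ→ℚ k)
  e-diff N j k 1≤j 1≤k = begin
    e N j - e N k
      ≡⟨ cong₂ _-_ (e≡V*node N j 1≤j) (e≡V*node N k 1≤k) ⟩
    V * node N j - V * node N k
      ≡⟨ solve 3 (λ V a b → V :* a :- V :* b := V :* (a :- b)) refl V (node N j) (node N k) ⟩
    V * (node N j - node N k)
      ≡⟨ cong (V *_) (node-diff N j k) ⟩
    V * (ℕ→ℚ j - ℕ→ℚ k) ∎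
    where open ≡-Reasoning

  e-injective : ∀ N j k → 1 ≤ j → 1 ≤ k → e N j ≡ e N k → j ≡ k
  e-injective N j k 1≤j 1≤k ej≡ek = expo-injective u v N j k u<v 1≤j 1≤k (ℕ→ℚ-injective _ _ ej≡ek)

  expo-shift : ∀ N ℓ → 1 ≤ ℓ → expo u v N (suc ℓ) ≡ expo u v (suc N) ℓ
  expo-shift N ℓ 1≤ℓ = begin
    N ℕ.* v ℕ.+ ((v ℕ.+ ℓ ℕ.* v) ∸ u)    ≡⟨ cong (N ℕ.* v ℕ.+_) (ℕP.+-∸-assoc v (u≤ℓv ℓ 1≤ℓ)) ⟩
    N ℕ.* v ℕ.+ (v ℕ.+ (ℓ ℕ.* v ∸ u))    ≡⟨ sym (ℕP.+-assoc (N ℕ.* v) v _) ⟩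
    N ℕ.* v ℕ.+ v ℕ.+ (ℓ ℕ.* v ∸ u)      ≡⟨ cong (ℕ._+ (ℓ ℕ.* v ∸ u)) (ℕP.+-comm (N ℕ.* v) v) ⟩
    suc N ℕ.* v ℕ.+ (ℓ ℕ.* v ∸ u)        ∎
    where open ≡-Reasoning

  term-raiseK : ∀ K N ℓ → 1 ≤ ℓ → ℓ ≤ K →
                b (suc K) N ℓ * (e N ℓ - e N (suc K)) ≡ - e N (suc K) * b K N ℓ
  term-raiseK K N ℓ 1≤ℓ ℓ≤K = begin
    b' * (e N ℓ - e N (suc K))
      ≡⟨ cong (b' *_) (e-diff N ℓ (suc K) 1≤ℓ (s≤s z≤n)) ⟩
    b' * (V * (ℕ→ℚ ℓ - ℕ→ℚ (suc K)))
      ≡⟨ cong (λ t → b' * (V * t)) gap ⟩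
    b' * (V * (- s))
      ≡⟨ solve 3 (λ b V s → b :* (V :* (:- s)) := (:- V) :* (b :* s)) refl b' V s ⟩
    (- V) * (b' * s)
      ≡⟨ cong ((- V) *_) (b-raiseK K N ℓ ℓ≤K) ⟩
    (- V) * (node N (suc K) * b K N ℓ)
      ≡⟨ solve 3 (λ V c b → (:- V) :* (c :* b) := (:- (V :* c)) :* b) refl V (node N (suc K)) (b K N ℓ) ⟩
    - (V * node N (suc K)) * b K N ℓ
      ≡⟨ cong (λ t → - t * b K N ℓ) (sym (e≡V*node N (suc K) (s≤s z≤n))) ⟩
    - e N (suc K) * b K N ℓ ∎
    where
    open ≡-Reasoning
    b' = b (suc K) N ℓ
    s = ℕ→ℚ (suc K ∸ ℓ)
    gap : ℕ→ℚ ℓ - ℕ→ℚ (suc K) ≡ - s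
    gap = trans (solve 2 (λ a b → a :- b := :- (b :- a)) refl (ℕ→ℚ ℓ) (ℕ→ℚ (suc K)))
                (cong -_ (sym (ℕ→ℚ-∸ (suc K) ℓ (ℕP.m≤n⇒m≤1+n ℓ≤K))))

  term-raiseN : ∀ K N ℓ → 1 ≤ ℓ →
                b (suc K) N (suc ℓ) * (e N (suc ℓ) - e N 1) ≡ - e N 1 * b K (suc N) ℓ
  term-raiseN K N ℓ 1≤ℓ = begin
    b' * (e N (suc ℓ) - e N 1)
      ≡⟨ cong (b' *_) (e-diff N (suc ℓ) 1 (s≤s z≤n) (s≤s z≤n)) ⟩
    b' * (V * (ℕ→ℚ (suc ℓ) - 1ℚ))
      ≡⟨ cong (λ t → b' * (V * (t - 1ℚ))) (ℕ→ℚ-suc ℓ) ⟩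
    b' * (V * (1ℚ + ℕ→ℚ ℓ - 1ℚ))
      ≡⟨ solve 3 (λ b V l → b :* (V :* (con 1ℚ :+ l :- con 1ℚ)) := V :* (b :* l)) refl b' V (ℕ→ℚ ℓ) ⟩
    V * (b' * ℕ→ℚ ℓ)
      ≡⟨ cong (V *_) (b-raiseℓ K N ℓ 1≤ℓ) ⟩
    V * - (node N 1 * b K (suc N) ℓ)
      ≡⟨ solve 3 (λ V c b → V :* (:- (c :* b)) := (:- (V :* c)) :* b) refl V (node N 1) (b K (suc N) ℓ) ⟩
    - (V * node N 1) * b K (suc N) ℓ
      ≡⟨ cong (λ t → - t * b K (suc N) ℓ) (sym (e≡V*node N 1 (s≤s z≤n))) ⟩
    - e N 1 * b K (suc N) ℓ ∎
    where
    open ≡-Reasoning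
    b' = b (suc K) N (suc ℓ)

  factor-term : ∀ β d Q γ β' → β * d ≡ γ * β' → β * (d * Q) ≡ γ * (β' * Q)
  factor-term β d Q γ β' eq = trans (sym (ℚP.*-assoc β d Q)) (trans (cong (_* Q) eq) (ℚP.*-assoc γ β' Q))

  vanishing-term : ∀ β e' Q → β * ((e' - e') * Q) ≡ 0ℚ
  vanishing-term β e' Q = solve 3 (λ β e Q → β :* ((e :- e) :* Q) := con 0ℚ) refl β e' Q

  Λ-raiseK : ∀ K N q → Λᵇ (suc K) N (λ i → (ℕ→ℚ i - e N (suc K)) * q i) ≡ - e N (suc K) * Λᵇ K N q
  Λ-raiseK K N q = begin
    (0ℚ - ε) * q 0 + (Σ₁ K F + F (suc K))
      ≡⟨ cong₂ (λ x y → (0ℚ - ε) * q 0 + (x + y))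
           (trans (Σ₁-cong K term) (Σ<-scale K (- ε) (λ i → b K N (suc i) * q (expo u v N (suc i)))))
           (vanishing-term (b (suc K) N (suc K)) ε (q (expo u v N (suc K)))) ⟩
    (0ℚ - ε) * q 0 + (- ε * S + 0ℚ)
      ≡⟨ solve 3 (λ ε x S → (con 0ℚ :- ε) :* x :+ ((:- ε) :* S :+ con 0ℚ) := (:- ε) :* (x :+ S))
               refl ε (q 0) S ⟩
    - ε * Λᵇ K N q ∎
    where
    open ≡-Reasoning
    ε = e N (suc K)
    F : ℕ → ℚ
    F ℓ = b (suc K) N ℓ * ((e N ℓ - ε) * q (expo u v N ℓ))
    S = Σ₁ K (λ ℓ → b K N ℓ * q (expo u v N ℓ))
    term : ∀ ℓ → 1 ≤ ℓ → ℓ ≤ K → F ℓ ≡ - ε * (b K N ℓ * q (expo u v N ℓ))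
    term ℓ 1≤ℓ ℓ≤K = factor-term (b (suc K) N ℓ) (e N ℓ - ε) (q (expo u v N ℓ)) (- ε) (b K N ℓ)
                                 (term-raiseK K N ℓ 1≤ℓ ℓ≤K)

  Λ-raiseN : ∀ K N q → Λᵇ (suc K) N (λ i → (ℕ→ℚ i - e N 1) * q i) ≡ - e N 1 * Λᵇ K (suc N) q
  Λ-raiseN K N q = begin
    (0ℚ - ε) * q 0 + Σ< (suc K) (λ i → F (suc i))
      ≡⟨ cong (λ t → (0ℚ - ε) * q 0 + t) (Σ<-front K (λ i → F (suc i))) ⟩
    (0ℚ - ε) * q 0 + (F 1 + Σ₁ K (λ ℓ → F (suc ℓ)))
      ≡⟨ cong₂ (λ x y → (0ℚ - ε) * q 0 + (x + y))
           (vanishing-term (b (suc K) N 1) ε (q (expo u v N 1)))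
           (trans (Σ₁-cong K shifted-term)
                  (Σ<-scale K (- ε) (λ i → b K (suc N) (suc i) * q (expo u v (suc N) (suc i))))) ⟩
    (0ℚ - ε) * q 0 + (0ℚ + - ε * S)
      ≡⟨ solve 3 (λ ε x S → (con 0ℚ :- ε) :* x :+ (con 0ℚ :+ (:- ε) :* S) := (:- ε) :* (x :+ S))
               refl ε (q 0) S ⟩
    - ε * Λᵇ K (suc N) q ∎
    where
    open ≡-Reasoning
    ε = e N 1
    F : ℕ → ℚ
    F ℓ = b (suc K) N ℓ * ((e N ℓ - ε) * q (expo u v N ℓ))
    S = Σ₁ K (λ ℓ → b K (suc N) ℓ * q (expo u v (suc N) ℓ))
    shifted-term : ∀ ℓ → 1 ≤ ℓ → ℓ ≤ K → F (suc ℓ) ≡ - ε * (b K (suc N) ℓ * q (expo u v (suc N) ℓ))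
    shifted-term ℓ 1≤ℓ _ =
      trans (cong (λ n → b (suc K) N (suc ℓ) * ((e N (suc ℓ) - ε) * q n)) (expo-shift N ℓ 1≤ℓ))
            (factor-term (b (suc K) N (suc ℓ)) (e N (suc ℓ) - ε) (q (expo u v (suc N) ℓ)) (- ε) (b K (suc N) ℓ)
                         (term-raiseN K N ℓ 1≤ℓ))

  Λ-linear-one : ∀ K N α →
                 Λᵇ K N (λ i → (ℕ→ℚ i - α) * one i) ≡ 1ℚ * Λᵇ K N ℕ→ℚ + (- α) * Λᵇ K N one
  Λ-linear-one K N α = trans (Λ-cong u v K N (b K N) expand-factor) (Λ-linear u v K N (b K N) 1ℚ (- α) ℕ→ℚ one)
    where
    expand-factor : ∀ i → (ℕ→ℚ i - α) * 1ℚ ≡ 1ℚ * ℕ→ℚ i + (- α) * 1ℚ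
    expand-factor i = solve 2 (λ x a → (x :- a) :* con 1ℚ := con 1ℚ :* x :+ (:- a) :* con 1ℚ) refl (ℕ→ℚ i) α

  -- The constant sequence: for K = 1 a direct computation; for K + 2 both
  -- recurrences kill (i - e)·1 for two distinct exponents e, hence 1 itself.
  Λ-one : ∀ K N → 1 ≤ K → Λᵇ K N one ≡ 0ℚ
  Λ-one (suc zero)    N _ = refl   -- 1 + b₁ with b₁ = -1
  Λ-one (suc (suc K)) N _ = ≢0-*-zero (εA - εB) g εA≢εB (begin
    (εA - εB) * g
      ≡⟨ solve 4 (λ a b x g → (a :- b) :* g := (con 1ℚ :* x :+ (:- b) :* g) :- (con 1ℚ :* x :+ (:- a) :* g))
                 refl εA εB ι g ⟩
    (1ℚ * ι + (- εB) * g) - (1ℚ * ι + (- εA) * g)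
      ≡⟨ cong₂ _-_ (killed εB (Λ-raiseN (suc K) N one) (Λ-one (suc K) (suc N) (s≤s z≤n)))
                  (killed εA (Λ-raiseK (suc K) N one) (Λ-one (suc K) N (s≤s z≤n))) ⟩
    0ℚ - 0ℚ
      ≡⟨⟩
    0ℚ ∎)
    where
    open ≡-Reasoning
    εA = e N (suc (suc K))
    εB = e N 1
    g = Λᵇ (suc (suc K)) N one
    ι = Λᵇ (suc (suc K)) N ℕ→ℚ
    killed : ∀ ε {x} → Λᵇ (suc (suc K)) N (λ i → (ℕ→ℚ i - ε) * one i) ≡ - ε * x → x ≡ 0ℚ →
             1ℚ * ι + (- ε) * g ≡ 0ℚ
    killed ε rec x≡0 = trans (sym (Λ-linear-one (suc (suc K)) N ε))
                             (trans rec (trans (cong (- ε *_) x≡0) (ℚP.*-zeroʳ (- ε))))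
    εA≢εB : εA - εB ≢ 0ℚ
    εA≢εB d≡0 = ℕP.1+n≢0 (ℕP.suc-injective
      (e-injective N (suc (suc K)) 1 (s≤s z≤n) (s≤s z≤n) (x∙y⁻¹≈ε⇒x≈y εA εB d≡0)))

  -- All binomial sequences of order < K, by induction on K and j through Pascal's identity.
  Λ-binom : ∀ K N j → j < K → Λᵇ K N (binom j) ≡ 0ℚ
  Λ-binom (suc K) N zero    _         = Λ-one (suc K) N (s≤s z≤n)
  Λ-binom (suc K) N (suc j) (s≤s j<K) = ≢0-*-zero (ℕ→ℚ (suc j)) X (ℕ→ℚ-nonZero (suc j)) (begin
    ℕ→ℚ (suc j) * X
      ≡⟨ sym (trans (cong (λ t → ℕ→ℚ (suc j) * X + t) lower) (ℚP.+-identityʳ _)) ⟩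
    ℕ→ℚ (suc j) * X + (ℕ→ℚ j - ε) * Λᵇ (suc K) N (binom j)
      ≡⟨ sym (Λ-linear u v (suc K) N (b (suc K) N) (ℕ→ℚ (suc j)) (ℕ→ℚ j - ε) (binom (suc j)) (binom j)) ⟩
    Λᵇ (suc K) N (λ i → ℕ→ℚ (suc j) * binom (suc j) i + (ℕ→ℚ j - ε) * binom j i)
      ≡⟨ sym (Λ-cong u v (suc K) N (b (suc K) N) pascal-shifted) ⟩
    Λᵇ (suc K) N (λ i → (ℕ→ℚ i - ε) * binom j i)
      ≡⟨ Λ-raiseK K N (binom j) ⟩
    - ε * Λᵇ K N (binom j)
      ≡⟨ cong (- ε *_) (Λ-binom K N j j<K) ⟩
    - ε * 0ℚ
      ≡⟨ ℚP.*-zeroʳ (- ε) ⟩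
    0ℚ ∎)
    where
    open ≡-Reasoning
    ε = e N (suc K)
    X = Λᵇ (suc K) N (binom (suc j))
    lower : (ℕ→ℚ j - ε) * Λᵇ (suc K) N (binom j) ≡ 0ℚ
    lower = trans (cong ((ℕ→ℚ j - ε) *_) (Λ-binom (suc K) N j (ℕP.m≤n⇒m≤1+n j<K)))
                  (ℚP.*-zeroʳ (ℕ→ℚ j - ε))
    pascal-shifted : ∀ i →
      (ℕ→ℚ i - ε) * binom j i ≡ ℕ→ℚ (suc j) * binom (suc j) i + (ℕ→ℚ j - ε) * binom j i
    pascal-shifted i = trans (solve 3 (λ x ε c → (x :- ε) :* c := x :* c :- ε :* c) refl (ℕ→ℚ i) ε (binom j i))
      (trans (cong (_- ε * binom j i) (pascal i j))
             (solve 5 (λ s c' J c ε → s :* c' :+ J :* c :- ε :* c := s :* c' :+ (J :- ε) :* c)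
                    refl (ℕ→ℚ (suc j)) (binom (suc j) i) (ℕ→ℚ j) (binom j i) ε))

top-exponent : ∀ u v K N → u ≤ K ℕ.* v → (K ℕ.+ N) ℕ.* v ∸ u ≡ expo u v N K
top-exponent u v K N u≤Kv =
  trans (cong (_∸ u) (trans (ℕP.*-distribʳ-+ v K N) (ℕP.+-comm (K ℕ.* v) (N ℕ.* v))))
        (ℕP.+-∸-assoc (N ℕ.* v) u≤Kv)

expo-mono : ∀ u v N ℓ K → ℓ ≤ K → expo u v N ℓ ≤ expo u v N K
expo-mono u v N ℓ K ℓ≤K = ℕP.+-monoʳ-≤ (N ℕ.* v) (ℕP.∸-monoˡ-≤ u (ℕP.*-monoˡ-≤ v ℓ≤K))

rhs-vanishes : ∀ u v K N b → VanishFrom (suc (expo u v N K)) (rhs u v K N b)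
rhs-vanishes u v K N b k eK<k = begin
  coeff (rhs u v K N b) k
    ≡⟨ sym (pair-δ k (rhs u v K N b)) ⟩
  ⟪ δ k ∣ rhs u v K N b ⟫
    ≡⟨ pair-rhs u v K N b (δ k) ⟩
  δ k 0 + Σ₁ K (λ ℓ → b ℓ * δ k (expo u v N ℓ))
    ≡⟨ cong₂ _+_ (δ-off k 0 (λ 0≡k → ℕP.<-irrefl 0≡k (ℕP.<-≤-trans (s≤s z≤n) eK<k)))
                (Σ<-zero K _ (λ i i<K → trans (cong (b (suc i) *_) (off (suc i) i<K))
                                              (ℚP.*-zeroʳ (b (suc i))))) ⟩
  0ℚ + 0ℚ
    ≡⟨⟩
  0ℚ ∎
  where
  open ≡-Reasoning
  off : ∀ ℓ → ℓ ≤ K → δ k (expo u v N ℓ) ≡ 0ℚ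
  off ℓ ℓ≤K = δ-off k (expo u v N ℓ)
    (λ eℓ≡k → ℕP.<-irrefl eℓ≡k (ℕP.<-≤-trans (s≤s (expo-mono u v N ℓ K ℓ≤K)) eK<k))

K≤top-exponent : ∀ u v K N → u < v → 1 ≤ K → K ≤ expo u v N K
K≤top-exponent u v (suc K) N u<v _ = ℕP.≤-trans (ℕP.m+n≤o⇒m≤o∸n (suc K) K+u≤Kv) (ℕP.m≤n+m _ (N ℕ.* v))
  where
  K+u≤Kv : suc K ℕ.+ u ≤ suc K ℕ.* v
  K+u≤Kv = subst (_≤ suc K ℕ.* v) (cong suc (ℕP.+-comm u K))
    (ℕP.+-mono-≤ u<v (ℕP.m≤m*n K v {{ℕ.>-nonZero (ℕP.≤-trans (s≤s z≤n) u<v)}}))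

lemma3p1 : (u v K N : ℕ) → u < v → 1 ≤ K →
    Σ (ℕ → ℚ) (λ a → Σ (ℕ → ℚ) (λ b → lhs u v K N a ≐ rhs u v K N b))
    × ((a b : ℕ → ℚ) → lhs u v K N a ≐ rhs u v K N b →
       (ℓ : ℕ) → 1 ≤ ℓ → ℓ ≤ K → b ℓ ≡ bFormula u v K N ℓ)
lemma3p1 u zero      K N () 1≤K
lemma3p1 u v@(suc v′) K N u<v 1≤K = (a , B , existence) , uniqueness
  where
  B = bFormula u v K N
  P = rhs u v K N B
  D = (K ℕ.+ N) ℕ.* v ∸ u
  open TaylorExpansion P using (a; expansion)

  D≡eK : D ≡ expo u v N K
  D≡eK = top-exponent u v K N (ℕP.≤-trans (ℕP.<⇒≤ u<v) (ℕP.m≤n*m v K {{ℕ.>-nonZero 1≤K}}))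

  -- the Taylor coefficients of P at 1 below K are Λ B (binom j) = 0
  low-coefficients : ∀ j → j < K → a j ≡ 0ℚ
  low-coefficients j j<K = trans (pair-rhs u v K N B (binom j)) (Vanishing.Λ-binom u v′ u<v K N j j<K)

  P-degree : VanishFrom (suc D) P
  P-degree = subst (λ n → VanishFrom (suc n) P) (sym D≡eK) (rhs-vanishes u v K N B)

  K≤D+1 : K ≤ suc D
  K≤D+1 = ℕP.m≤n⇒m≤1+n (subst (K ≤_) (sym D≡eK) (K≤top-exponent u v K N u<v 1≤K))

  -- lhs and P pair equally with every q: both give the Taylor expansion of P at 1
  existence : lhs u v K N a ≐ P
  existence = pair-ext (lhs u v K N a) P (λ q →
    trans (pair-lhs u v K N a q) (sym (expansion D K P-degree low-coefficients K≤D+1 q)))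

  uniqueness : (a' b : ℕ → ℚ) → lhs u v K N a' ≐ rhs u v K N b →
               (ℓ : ℕ) → 1 ≤ ℓ → ℓ ≤ K → b ℓ ≡ B ℓ
  -- both b and B make Λ vanish on all sequences of degree < K
  uniqueness a' b solution = coefficients-determined u v K N b B u<v (λ q deg →
    trans (solution-Λ-vanishes u v K N a' b solution q deg)
          (sym (solution-Λ-vanishes u v K N a B existence q deg)))
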